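{- Let $n\ge 1$ be an integer and let $G=\mathrm{PAH}_n$. Then (1) $\prod_{u\in V(G)} d(u)^2 = 3^{12n^2}$; (2) $\prod_{uv\in E(G)} d(u)d(v) = 3^{18n^2}$; (3) $\prod_{v\in V(G)} d(v) = 3^{6n^2}$; (4) $\prod_{uv\in E(G)}(d(u)+d(v)) = 4^{6n}\times 6^{9n^2-3n}$; (5) $\prod_{uv\in E(G)}(d(u)+d(v))^2 = 4^{12n}\times 6^{18n^2-6n}$; (6) $\prod_{uv\in E(G)}(d(u)d(v))^2 = 3^{36n^2}$.
   Context: For a graph $G$, $d(v)$ denotes the degree of vertex $v$. The family $\mathrm{PAH}_n$ of graphs is defined recursively. $\mathrm{PAH}_1$ is the 6-cycle with one pendant vertex (leaf) attached to each of its six vertices (the graph of benzene). For $n\ge 1$, $\mathrm{PAH}_{n+1}$ is obtained from $\mathrm{PAH}_n$ by deleting all its leaves, then gluing a hexagon (6-cycle) onto each exterior edge (so that the hexagons form the next concentric hexagonal layer of the hexagonal lattice around the existing hexagonal system), and finally attaching one leaf to each exterior vertex of degree 2. Thus $\mathrm{PAH}_n$ consists of a hexagonal-shaped piece of the hexagonal lattice with $n$ hexagons on each side, every vertex of degree 2 of which receives a pendant leaf. -}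

module Defs where

open import Data.Nat as ℕ using (ℕ; zero; suc; _∸_; _≤?_)
open import Data.Integer as ℤ using (ℤ; +_; ∣_∣)
open import Data.Product using (_×_; _,_; proj₁; proj₂)
import Data.Product.Properties as ProdP
open import Data.Sum using (_⊎_; inj₁; inj₂)
import Data.Sum.Properties as SumP
open import Data.List using (List; []; _∷_; map; filter; length; concatMap; deduplicate; upTo; _++_; cartesianProduct)
open import Relation.Nullary using (Dec)
open import Relation.Nullary.Decidable using (_×-dec_; _⊎-dec_)
open import Relation.Binary.PropositionalEquality using (_≡_)

-- Points of the triangular lattice, in axial coordinates (a , b); the six
-- lattice neighbours of p are p + (±1,0), p + (0,±1), p ± (-1,1).
-- The hexagonal (honeycomb) lattice is the triangular lattice with the
-- index-3 sublattice of hexagon centres  c = i·(1,1) + j·(1,-2)  removed;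
-- the six corners of the hexagon centred at c are its six triangular
-- neighbours (listed below in cyclic order), and its six edges join
-- cyclically consecutive corners.
Pt : Set
Pt = ℤ × ℤ

_≟ₚ_ : (p q : Pt) → Dec (p ≡ q)
_≟ₚ_ = ProdP.≡-dec ℤ._≟_ ℤ._≟_

_⊕_ : Pt → Pt → Pt
(a , b) ⊕ (c , d) = (a ℤ.+ c , b ℤ.+ d)

δ₀ δ₁ δ₂ δ₃ δ₄ δ₅ : Pt
δ₀ = (+ 1 , + 0)
δ₁ = (+ 0 , + 1)
δ₂ = (ℤ.-[1+ 0 ] , + 1)
δ₃ = (ℤ.-[1+ 0 ] , + 0)
δ₄ = (+ 0 , ℤ.-[1+ 0 ])
δ₅ = (+ 1 , ℤ.-[1+ 0 ])

corners : Pt → List Pt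
corners c = map (c ⊕_) (δ₀ ∷ δ₁ ∷ δ₂ ∷ δ₃ ∷ δ₄ ∷ δ₅ ∷ [])

hexEdges : Pt → List (Pt × Pt)
hexEdges c = (c ⊕ δ₀ , c ⊕ δ₁) ∷ (c ⊕ δ₁ , c ⊕ δ₂) ∷ (c ⊕ δ₂ , c ⊕ δ₃)
           ∷ (c ⊕ δ₃ , c ⊕ δ₄) ∷ (c ⊕ δ₄ , c ⊕ δ₅) ∷ (c ⊕ δ₅ , c ⊕ δ₀) ∷ []

range : ℕ → List ℤ
range m = map (λ k → (+ k) ℤ.- (+ m)) (upTo (2 ℕ.* m ℕ.+ 1))

toCentre : ℤ × ℤ → Pt
toCentre (i , j) = (i ℤ.+ j , i ℤ.- (+ 2) ℤ.* j)

-- In centre-lattice coordinates the six neighbouring hexagons of (i,j) are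
-- (i,j) ± (1,0), ± (0,1), ± (1,1); the hexagon distance from the origin is
-- max(|i|,|j|,|i-j|).  The hexagonal-shaped benzenoid with n hexagons on
-- each side consists of the hexagons at distance ≤ n-1 from the central one.
centres : ℕ → List Pt
centres n = map toCentre
  (filter (λ ij → ∣ proj₁ ij ℤ.- proj₂ ij ∣ ≤? (n ∸ 1))
          (cartesianProduct (range (n ∸ 1)) (range (n ∸ 1))))

SameEdge : Pt × Pt → Pt × Pt → Set
SameEdge (p , q) (p' , q') = (p ≡ p' × q ≡ q') ⊎ (p ≡ q' × q ≡ p')

sameEdge? : (e f : Pt × Pt) → Dec (SameEdge e f)
sameEdge? (p , q) (p' , q') =
  ((p ≟ₚ p') ×-dec (q ≟ₚ q')) ⊎-dec ((p ≟ₚ q') ×-dec (q ≟ₚ p'))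

benzVerts : ℕ → List Pt
benzVerts n = deduplicate _≟ₚ_ (concatMap corners (centres n))

benzEdges : ℕ → List (Pt × Pt)
benzEdges n = deduplicate sameEdge? (concatMap hexEdges (centres n))

-- degree of a vertex in a (loopless, simple) graph given by an edge list
degree : {V : Set} → ((x y : V) → Dec (x ≡ y)) → List (V × V) → V → ℕ
degree _≟_ E v = length (filter (λ e → (v ≟ proj₁ e) ⊎-dec (v ≟ proj₂ e)) E)

-- vertices of degree 2 of the benzenoid: these receive a pendant leaf
deg2 : ℕ → List Pt
deg2 n = filter (λ p → degree _≟ₚ_ (benzEdges n) p ℕ.≟ 2) (benzVerts n)

-- vertices of PAH_n : inj₁ p = lattice vertex p, inj₂ p = the leaf attached to p
Vtx : Set
Vtx = Pt ⊎ Pt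

_≟ᵥ_ : (x y : Vtx) → Dec (x ≡ y)
_≟ᵥ_ = SumP.≡-dec _≟ₚ_ _≟ₚ_

PAH-V : ℕ → List Vtx
PAH-V n = map inj₁ (benzVerts n) ++ map inj₂ (deg2 n)

PAH-E : ℕ → List (Vtx × Vtx)
PAH-E n = map (λ e → (inj₁ (proj₁ e) , inj₁ (proj₂ e))) (benzEdges n)
       ++ map (λ p → (inj₁ p , inj₂ p)) (deg2 n)

d : ℕ → Vtx → ℕ
d n = degree _≟ᵥ_ (PAH-E n)

module Submission where

-- Every vertex of the benzenoid has degree 2 or 3, there are 6n² of them, and the 6n vertices of
-- degree 2 are those receiving a leaf; by the handshake lemma the benzenoid has 9n² − 3n edges.
-- In PAH_n every lattice vertex has degree 3 and every leaf degree 1, so each product is a product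
-- of powers whose exponents are these three counts.
--
-- The counts come from the rotation by 60°, which preserves the benzenoid. The degree of a lattice
-- point p is the number of the six directions k for which one of the two hexagons containing the
-- edge from p to p ⊕ δ k belongs to the benzenoid, so it is invariant under the rotation. The vertices
-- fall into six sectors, the rotations of the corners corner₀ (s , t) with 0 ≤ s, t < n, and such a
-- corner has degree 2 exactly when s = n − 1.

open import Defs
open import Level using (Level)
open import Data.Nat as ℕ using (ℕ; zero; suc; _+_; _*_; _^_; _∸_; _≤_; _<_; _≟_; _≤?_; s≤s; z≤n)
import Data.Nat.Properties as ℕ
open import Algebra.Properties.CommutativeSemigroup ℕ.+-commutativeSemigroup using () renaming (interchange to +-interchange)
import Data.Nat.Tactic.RingSolver as ℕ-Solver
open import Data.Nat.ListAction using (sum; product)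
open import Data.Nat.ListAction.Properties using (product-++)
open import Data.Integer as ℤ using (ℤ; +_; -[1+_]; -_; ∣_∣)
import Data.Integer.Properties as ℤ
open import Algebra.Properties.AbelianGroup ℤ.+-0-abelianGroup using () renaming (∙-cancelˡ to +-cancelˡ; ∙-cancelʳ to +-cancelʳ)
open import Data.Integer.Tactic.RingSolver using (solve-∀)
open import Data.List using (List; []; _∷_; [_]; _++_; map; filter; length; upTo; cartesianProduct; concatMap; deduplicate)
open import Data.List.Properties using (map-cong; map-++; map-∘; length-++; length-map; length-upTo)
open import Data.List.Membership.Propositional using (_∈_; _∉_; find; lose)
open import Data.List.Membership.Propositional.Properties
  using (∈-map⁺; ∈-map⁻; ∈-filter⁺; ∈-filter⁻; ∈-upTo⁺; ∈-upTo⁻; ∈-cartesianProduct⁺; ∈-cartesianProduct⁻; ∈-deduplicate⁺; ∈-deduplicate⁻)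
open import Data.List.Membership.Propositional.Properties.WithK using (unique∧set⇒bag)
open import Data.List.Membership.DecPropositional _≟ₚ_ using (_∈?_)
open import Data.List.Relation.Unary.Any using (Any; here; there; any?)
import Data.List.Relation.Unary.Any.Properties as Any
open import Data.List.Relation.Unary.All using ([]; _∷_)
import Data.List.Relation.Unary.All as All
open import Data.List.Relation.Unary.AllPairs using (AllPairs; []; _∷_)
open import Data.List.Relation.Unary.Unique.Propositional using (Unique)
import Data.List.Relation.Unary.Unique.Propositional.Properties as Unique
open import Data.List.Relation.Unary.Unique.DecPropositional.Properties _≟ₚ_ using (deduplicate-!)
import Data.List.Relation.Unary.Unique.DecSetoid.Properties as UniqueSetoid
open import Data.List.Relation.Binary.BagAndSetEquality using (∼bag⇒↭)
open import Data.List.Relation.Binary.Permutation.Propositional using (_↭_; ↭-sym)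
open import Data.List.Relation.Binary.Permutation.Propositional.Properties using (↭-length; filter-↭; shift)
open import Data.Product using (Σ; _×_; _,_; proj₁; proj₂)
open import Data.Sum using (_⊎_; inj₁; inj₂; [_,_]′)
import Data.Sum
import Data.Sum.Properties as Sum
open import Data.Empty using (⊥; ⊥-elim)
open import Function using (_∘_; _∘′_; id; _⇔_; mk⇔; Equivalence)
open import Relation.Nullary using (Dec; yes; no; ¬_)
open import Relation.Nullary.Decidable using (_⊎-dec_)
open import Relation.Unary using (Pred; Decidable)
open import Relation.Binary.Bundles using (DecSetoid)
open import Relation.Binary.Definitions using (DecidableEquality)
open import Relation.Binary.Structures using (IsEquivalence)
open import Relation.Binary.PropositionalEquality using (_≡_; _≢_; refl; sym; trans; cong; cong₂; subst; module ≡-Reasoning)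

private variable
  a ℓ ℓ′ : Level
  A B C : Set a

count : {P : Pred A ℓ} → Decidable P → List A → ℕ
count P? xs = length (filter P? xs)

module _ {P : Pred A ℓ} (P? : Decidable P) where

  count-∷ : ∀ x xs → count P? (x ∷ xs) ≡ count P? [ x ] + count P? xs
  count-∷ x xs with P? x
  ... | yes _ = refl
  ... | no _  = refl

  count-yes : ∀ {x} xs → P x → count P? (x ∷ xs) ≡ suc (count P? xs)
  count-yes {x} xs px with P? x
  ... | yes _ = refl
  ... | no ¬px = ⊥-elim (¬px px)

  count-no : ∀ {x} xs → ¬ P x → count P? (x ∷ xs) ≡ count P? xs
  count-no {x} xs ¬px with P? x
  ... | yes px = ⊥-elim (¬px px)
  ... | no _ = refl

  count-++ : ∀ xs ys → count P? (xs ++ ys) ≡ count P? xs + count P? ys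
  count-++ [] ys = refl
  count-++ (x ∷ xs) ys rewrite count-∷ x (xs ++ ys) | count-∷ x xs =
    trans (cong (_+_ (count P? [ x ])) (count-++ xs ys)) (sym (ℕ.+-assoc (count P? [ x ]) _ _))

  count-none : ∀ xs → (∀ {x} → x ∈ xs → ¬ P x) → count P? xs ≡ 0
  count-none [] _ = refl
  count-none (x ∷ xs) ¬P = trans (count-no xs (¬P (here refl))) (count-none xs (¬P ∘′ there))

  count-all : ∀ xs → (∀ {x} → x ∈ xs → P x) → count P? xs ≡ length xs
  count-all [] _ = refl
  count-all (x ∷ xs) allP = trans (count-yes xs (allP (here refl))) (cong suc (count-all xs (allP ∘′ there)))

  count-↭ : ∀ {xs ys} → xs ↭ ys → count P? xs ≡ count P? ys
  count-↭ xs↭ys = ↭-length (filter-↭ P? xs↭ys)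

  count-map : (f : B → A) (xs : List B) → count P? (map f xs) ≡ count (λ x → P? (f x)) xs
  count-map f [] = refl
  count-map f (x ∷ xs) with P? (f x)
  ... | yes _ = cong suc (count-map f xs)
  ... | no _  = count-map f xs

  count-unique : ∀ {xs x} → Unique xs → x ∈ xs → P x → (∀ {y} → y ∈ xs → P y → y ≡ x) → count P? xs ≡ 1
  count-unique {y ∷ xs} (y∉xs ∷ !xs) (here refl) px only =
    trans (count-yes xs px) (cong suc (count-none xs λ z∈xs pz → All.lookup y∉xs z∈xs (sym (only (there z∈xs) pz))))
  count-unique {y ∷ xs} (y∉xs ∷ !xs) (there x∈xs) px only =
    trans (count-no xs λ py → All.lookup y∉xs x∈xs (only (here refl) py))
          (count-unique !xs x∈xs px (λ z∈xs → only (there z∈xs)))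

module _ {P : Pred A ℓ} {Q : Pred A ℓ′} (P? : Decidable P) (Q? : Decidable Q) where

  count-cong : ∀ xs → (∀ {x} → x ∈ xs → P x → Q x) → (∀ {x} → x ∈ xs → Q x → P x) → count P? xs ≡ count Q? xs
  count-cong [] _ _ = refl
  count-cong (x ∷ xs) P⇒Q Q⇒P with P? x | Q? x
  ... | yes _  | yes _  = cong suc (count-cong xs (P⇒Q ∘′ there) (Q⇒P ∘′ there))
  ... | no _   | no _   = count-cong xs (P⇒Q ∘′ there) (Q⇒P ∘′ there)
  ... | yes px | no ¬qx = ⊥-elim (¬qx (P⇒Q (here refl) px))
  ... | no ¬px | yes qx = ⊥-elim (¬px (Q⇒P (here refl) qx))

  count-⊎ : ∀ xs → (∀ {x} → x ∈ xs → P x → ¬ Q x) →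
    count (λ x → P? x ⊎-dec Q? x) xs ≡ count P? xs + count Q? xs
  count-⊎ [] _ = refl
  count-⊎ (x ∷ xs) disjoint with P? x | Q? x
  ... | yes px | yes qx = ⊥-elim (disjoint (here refl) px qx)
  ... | yes _  | no _   = cong suc (count-⊎ xs (disjoint ∘′ there))
  ... | no _   | yes _  = trans (cong suc (count-⊎ xs (disjoint ∘′ there))) (sym (ℕ.+-suc _ _))
  ... | no _   | no _   = count-⊎ xs (disjoint ∘′ there)

sum-map-+ : (f g : A → ℕ) (xs : List A) → sum (map (λ x → f x + g x) xs) ≡ sum (map f xs) + sum (map g xs)
sum-map-+ f g [] = refl
sum-map-+ f g (x ∷ xs) rewrite sum-map-+ f g xs = +-interchange (f x) (g x) _ _

sum-count-singleton : {R : A → B → Set ℓ} (y : B) (R? : ∀ x → Decidable (R x)) (xs : List A) →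
  sum (map (λ x → count (R? x) [ y ]) xs) ≡ count (λ x → R? x y) xs
sum-count-singleton y R? [] = refl
sum-count-singleton y R? (x ∷ xs) with R? x y
... | yes _ = cong suc (sum-count-singleton y R? xs)
... | no _  = sum-count-singleton y R? xs

length-cartesianProduct : (xs : List A) (ys : List B) → length (cartesianProduct xs ys) ≡ length xs * length ys
length-cartesianProduct [] ys = refl
length-cartesianProduct (x ∷ xs) ys = trans (length-++ (map (x ,_) ys)) (cong₂ _+_ (length-map (x ,_) ys) (length-cartesianProduct xs ys))

module _ {P : Pred B ℓ} (P? : Decidable P) where

  count-cartesianProduct-proj₂ : (xs : List A) (ys : List B) →
    count (λ xy → P? (proj₂ xy)) (cartesianProduct xs ys) ≡ length xs * count P? ys
  count-cartesianProduct-proj₂ [] ys = refl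
  count-cartesianProduct-proj₂ (x ∷ xs) ys = trans (count-++ (λ xy → P? (proj₂ xy)) (map (x ,_) ys) _)
    (cong₂ _+_ (count-map (λ xy → P? (proj₂ xy)) (x ,_) ys) (count-cartesianProduct-proj₂ xs ys))

module _ {P : Pred A ℓ} (P? : Decidable P) where

  count-cartesianProduct-proj₁ : (xs : List A) (ys : List B) →
    count (λ xy → P? (proj₁ xy)) (cartesianProduct xs ys) ≡ count P? xs * length ys
  count-cartesianProduct-proj₁ [] ys = refl
  count-cartesianProduct-proj₁ (x ∷ xs) ys = begin
    count (λ xy → P? (proj₁ xy)) (map (x ,_) ys ++ cartesianProduct xs ys)
      ≡⟨ count-++ (λ xy → P? (proj₁ xy)) (map (x ,_) ys) _ ⟩
    count (λ xy → P? (proj₁ xy)) (map (x ,_) ys) + count (λ xy → P? (proj₁ xy)) (cartesianProduct xs ys)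
      ≡⟨ cong₂ _+_ (trans (count-map (λ xy → P? (proj₁ xy)) (x ,_) ys) (count-constant ys)) (count-cartesianProduct-proj₁ xs ys) ⟩
    count P? [ x ] * length ys + count P? xs * length ys
      ≡⟨ ℕ.*-distribʳ-+ (length ys) (count P? [ x ]) (count P? xs) ⟨
    (count P? [ x ] + count P? xs) * length ys
      ≡⟨ cong (_* length ys) (count-∷ P? x xs) ⟨
    count P? (x ∷ xs) * length ys ∎
    where
    open ≡-Reasoning
    count-constant : ∀ zs → count (λ (_ : B) → P? x) zs ≡ count P? [ x ] * length zs
    count-constant zs with P? x
    ... | yes px = trans (count-all (λ _ → yes px) zs (λ _ → px)) (sym (ℕ.+-identityʳ (length zs)))
    ... | no ¬px = count-none (λ _ → no ¬px) zs (λ _ → ¬px)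

count≡sum : {P : Pred A ℓ} (P? : Decidable P) (xs : List A) → count P? xs ≡ sum (map (λ x → count P? [ x ]) xs)
count≡sum P? [] = refl
count≡sum P? (x ∷ xs) = trans (count-∷ P? x xs) (cong (_+_ (count P? [ x ])) (count≡sum P? xs))

sum-map-const : (f : A → ℕ) (c : ℕ) (xs : List A) → (∀ {x} → x ∈ xs → f x ≡ c) → sum (map f xs) ≡ c * length xs
sum-map-const f c [] _ = sym (ℕ.*-zeroʳ c)
sum-map-const f c (x ∷ xs) f≡c = trans (cong₂ _+_ (f≡c (here refl)) (sum-map-const f c xs (f≡c ∘′ there))) (sym (ℕ.*-suc c (length xs)))

product-map-const : (f : A → ℕ) (c : ℕ) (xs : List A) → (∀ {x} → x ∈ xs → f x ≡ c) → product (map f xs) ≡ c ^ length xs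
product-map-const f c [] _ = refl
product-map-const f c (x ∷ xs) f≡c = cong₂ _*_ (f≡c (here refl)) (product-map-const f c xs (f≡c ∘′ there))

product-map-++-const : (f : A → ℕ) (g : B → A) (h : C → A) (xs : List B) (ys : List C) {a b : ℕ} →
  (∀ {x} → x ∈ xs → f (g x) ≡ a) → (∀ {y} → y ∈ ys → f (h y) ≡ b) →
  product (map f (map g xs ++ map h ys)) ≡ a ^ length xs * b ^ length ys
product-map-++-const f g h xs ys fg≡a fh≡b = begin
  product (map f (map g xs ++ map h ys))                 ≡⟨ cong product (map-++ f (map g xs) (map h ys)) ⟩
  product (map f (map g xs) ++ map f (map h ys))          ≡⟨ product-++ (map f (map g xs)) (map f (map h ys)) ⟩
  product (map f (map g xs)) * product (map f (map h ys)) ≡⟨ cong₂ _*_ (cong product (map-∘ xs)) (cong product (map-∘ ys)) ⟨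
  product (map (f ∘ g) xs) * product (map (f ∘ h) ys)     ≡⟨ cong₂ _*_ (product-map-const (f ∘ g) _ xs fg≡a) (product-map-const (f ∘ h) _ ys fh≡b) ⟩
  _ ^ length xs * _ ^ length ys                          ∎
  where open ≡-Reasoning

module _ {X : Set} (_≟_ : DecidableEquality X) where

  count-endpoints : ∀ {vs u v} → Unique vs → u ≢ v → u ∈ vs → v ∈ vs →
    count (λ w → (w ≟ u) ⊎-dec (w ≟ v)) vs ≡ 2
  count-endpoints {vs} {u} {v} !vs u≢v u∈vs v∈vs = begin
    count (λ w → (w ≟ u) ⊎-dec (w ≟ v)) vs  ≡⟨ count-⊎ (_≟ u) (_≟ v) vs (λ _ w≡u w≡v → u≢v (trans (sym w≡u) w≡v)) ⟩
    count (_≟ u) vs + count (_≟ v) vs      ≡⟨ cong₂ _+_ (count-unique (_≟ u) !vs u∈vs refl (λ _ → id))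
                                                          (count-unique (_≟ v) !vs v∈vs refl (λ _ → id)) ⟩
    2                                      ∎
    where open ≡-Reasoning

  handshake : ∀ {vs} → Unique vs → (es : List (X × X)) →
    (∀ {e} → e ∈ es → proj₁ e ≢ proj₂ e × proj₁ e ∈ vs × proj₂ e ∈ vs) →
    sum (map (degree _≟_ es) vs) ≡ 2 * length es
  handshake {vs} !vs [] _ = sum-zeros vs
    where
    sum-zeros : ∀ ws → sum (map (degree _≟_ []) ws) ≡ 0
    sum-zeros [] = refl
    sum-zeros (_ ∷ ws) = sum-zeros ws
  handshake {vs} !vs (e ∷ es) valid = begin
    sum (map (degree _≟_ (e ∷ es)) vs)
      ≡⟨ cong sum (map-cong (λ v → count-∷ (incident v) e es) vs) ⟩
    sum (map (λ v → count (incident v) [ e ] + degree _≟_ es v) vs)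
      ≡⟨ sum-map-+ (λ v → count (incident v) [ e ]) (degree _≟_ es) vs ⟩
    sum (map (λ v → count (incident v) [ e ]) vs) + sum (map (degree _≟_ es) vs)
      ≡⟨ cong₂ _+_ (sum-count-singleton e incident vs) (handshake !vs es (valid ∘′ there)) ⟩
    count (λ v → incident v e) vs + 2 * length es
      ≡⟨ cong (_+ 2 * length es) (count-endpoints !vs u≢v u∈vs v∈vs) ⟩
    2 + 2 * length es
      ≡⟨ ℕ.*-distribˡ-+ 2 1 (length es) ⟨
    2 * length (e ∷ es) ∎
    where
    open ≡-Reasoning
    incident : ∀ v f → Dec ((v ≡ proj₁ f) ⊎ (v ≡ proj₂ f))
    incident v f = (v ≟ proj₁ f) ⊎-dec (v ≟ proj₂ f)
    u≢v = proj₁ (valid (here refl))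
    u∈vs = proj₁ (proj₂ (valid (here refl)))
    v∈vs = proj₂ (proj₂ (valid (here refl)))

-- The triangular lattice

data Dir : Set where
  dir₀ dir₁ dir₂ dir₃ dir₄ dir₅ : Dir

δ : Dir → Pt
δ dir₀ = δ₀
δ dir₁ = δ₁
δ dir₂ = δ₂
δ dir₃ = δ₃
δ dir₄ = δ₄
δ dir₅ = δ₅

next : Dir → Dir
next dir₀ = dir₁
next dir₁ = dir₂
next dir₂ = dir₃
next dir₃ = dir₄
next dir₄ = dir₅
next dir₅ = dir₀

prev : Dir → Dir
prev dir₀ = dir₅
prev dir₁ = dir₀
prev dir₂ = dir₁
prev dir₃ = dir₂
prev dir₄ = dir₃
prev dir₅ = dir₄

allDirs : List Dir
allDirs = dir₀ ∷ dir₁ ∷ dir₂ ∷ dir₃ ∷ dir₄ ∷ dir₅ ∷ []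

∈-allDirs : ∀ k → k ∈ allDirs
∈-allDirs dir₀ = here refl
∈-allDirs dir₁ = there (here refl)
∈-allDirs dir₂ = there (there (here refl))
∈-allDirs dir₃ = there (there (there (here refl)))
∈-allDirs dir₄ = there (there (there (there (here refl))))
∈-allDirs dir₅ = there (there (there (there (there (here refl)))))

allDirs-unique : Unique allDirs
allDirs-unique = ((λ ()) ∷ (λ ()) ∷ (λ ()) ∷ (λ ()) ∷ (λ ()) ∷ [])
               ∷ ((λ ()) ∷ (λ ()) ∷ (λ ()) ∷ (λ ()) ∷ [])
               ∷ ((λ ()) ∷ (λ ()) ∷ (λ ()) ∷ [])
               ∷ ((λ ()) ∷ (λ ()) ∷ [])
               ∷ ((λ ()) ∷ [])
               ∷ [] ∷ []

-- a left inverse of δ; its value off the six unit vectors is irrelevant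
dirOf : Pt → Dir
dirOf (+ 0 , + 1)         = dir₁
dirOf (-[1+ 0 ] , + 1)    = dir₂
dirOf (-[1+ 0 ] , + 0)    = dir₃
dirOf (+ 0 , -[1+ 0 ])    = dir₄
dirOf (+ 1 , -[1+ 0 ])    = dir₅
dirOf _                   = dir₀

dirOf-δ : ∀ k → dirOf (δ k) ≡ k
dirOf-δ dir₀ = refl
dirOf-δ dir₁ = refl
dirOf-δ dir₂ = refl
dirOf-δ dir₃ = refl
dirOf-δ dir₄ = refl
dirOf-δ dir₅ = refl

δ-injective : ∀ {j k} → δ j ≡ δ k → j ≡ k
δ-injective {j} {k} eq = trans (sym (dirOf-δ j)) (trans (cong dirOf eq) (dirOf-δ k))

0ₚ : Pt
0ₚ = (+ 0 , + 0)

δ≢0ₚ : ∀ k → δ k ≢ 0ₚ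
δ≢0ₚ dir₀ ()
δ≢0ₚ dir₁ ()
δ≢0ₚ dir₂ ()
δ≢0ₚ dir₃ ()
δ≢0ₚ dir₄ ()
δ≢0ₚ dir₅ ()

δ-opposite : ∀ k → δ k ⊕ δ (next (next (next k))) ≡ 0ₚ
δ-opposite dir₀ = refl
δ-opposite dir₁ = refl
δ-opposite dir₂ = refl
δ-opposite dir₃ = refl
δ-opposite dir₄ = refl
δ-opposite dir₅ = refl

δ-between : ∀ k → δ k ⊕ δ (next (next k)) ≡ δ (next k)
δ-between dir₀ = refl
δ-between dir₁ = refl
δ-between dir₂ = refl
δ-between dir₃ = refl
δ-between dir₄ = refl
δ-between dir₅ = refl

next-prev : ∀ k → next (prev k) ≡ k
next-prev dir₀ = refl
next-prev dir₁ = refl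
next-prev dir₂ = refl
next-prev dir₃ = refl
next-prev dir₄ = refl
next-prev dir₅ = refl

δ-between-prev : ∀ k → δ (next k) ⊕ δ (prev k) ≡ δ k
δ-between-prev dir₀ = refl
δ-between-prev dir₁ = refl
δ-between-prev dir₂ = refl
δ-between-prev dir₃ = refl
δ-between-prev dir₄ = refl
δ-between-prev dir₅ = refl

δ-opposite-next : ∀ k → δ (next k) ⊕ δ (prev (prev k)) ≡ 0ₚ
δ-opposite-next dir₀ = refl
δ-opposite-next dir₁ = refl
δ-opposite-next dir₂ = refl
δ-opposite-next dir₃ = refl
δ-opposite-next dir₄ = refl
δ-opposite-next dir₅ = refl

δ-opposite-prev : ∀ k → δ (prev k) ⊕ δ (next (next k)) ≡ 0ₚ
δ-opposite-prev dir₀ = refl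
δ-opposite-prev dir₁ = refl
δ-opposite-prev dir₂ = refl
δ-opposite-prev dir₃ = refl
δ-opposite-prev dir₄ = refl
δ-opposite-prev dir₅ = refl

⊕-assoc : ∀ p q r → (p ⊕ q) ⊕ r ≡ p ⊕ (q ⊕ r)
⊕-assoc (a , b) (c , d) (e , f) = cong₂ _,_ (ℤ.+-assoc a c e) (ℤ.+-assoc b d f)

⊕-comm : ∀ p q → p ⊕ q ≡ q ⊕ p
⊕-comm (a , b) (c , d) = cong₂ _,_ (ℤ.+-comm a c) (ℤ.+-comm b d)

⊕-identityʳ : ∀ p → p ⊕ 0ₚ ≡ p
⊕-identityʳ (a , b) = cong₂ _,_ (ℤ.+-identityʳ a) (ℤ.+-identityʳ b)

⊕-cancelˡ : ∀ p {q r} → p ⊕ q ≡ p ⊕ r → q ≡ r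
⊕-cancelˡ (a , b) {c , d} {e , f} eq =
  cong₂ _,_ (+-cancelˡ a c e (cong proj₁ eq)) (+-cancelˡ b d f (cong proj₂ eq))

⊕-shift : ∀ q {u v w} → u ⊕ v ≡ w → (q ⊕ u) ⊕ v ≡ q ⊕ w
⊕-shift q {u} {v} u⊕v≡w = trans (⊕-assoc q u v) (cong (q ⊕_) u⊕v≡w)

⊕-return : ∀ q {u v} → u ⊕ v ≡ 0ₚ → (q ⊕ u) ⊕ v ≡ q
⊕-return q u⊕v≡0 = trans (⊕-shift q u⊕v≡0) (⊕-identityʳ q)

p⊕δ≢p : ∀ p k → p ⊕ δ k ≢ p
p⊕δ≢p p k eq = δ≢0ₚ k (⊕-cancelˡ p (trans eq (sym (⊕-identityʳ p))))

-- the rotation by 60° about the origin, the centre of the central hexagon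
rot : Pt → Pt
rot (a , b) = (- b , a ℤ.+ b)

rotate : ℕ → Pt → Pt
rotate zero p = p
rotate (suc r) p = rot (rotate r p)

rot-⊕ : ∀ p q → rot (p ⊕ q) ≡ rot p ⊕ rot q
rot-⊕ (a , b) (c , d) = cong₂ _,_ (ℤ.neg-distrib-+ b d) (interchange a c b d)
  where
  interchange : ∀ a c b d → (a ℤ.+ c) ℤ.+ (b ℤ.+ d) ≡ (a ℤ.+ b) ℤ.+ (c ℤ.+ d)
  interchange = solve-∀

rot-δ : ∀ k → rot (δ k) ≡ δ (next k)
rot-δ dir₀ = refl
rot-δ dir₁ = refl
rot-δ dir₂ = refl
rot-δ dir₃ = refl
rot-δ dir₄ = refl
rot-δ dir₅ = refl

rot-corner : ∀ p k → rot (p ⊕ δ k) ≡ rot p ⊕ δ (next k)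
rot-corner p k = trans (rot-⊕ p (δ k)) (cong (rot p ⊕_) (rot-δ k))

neg : Pt → Pt
neg (a , b) = (- a , - b)

rot³≡neg : ∀ p → rot (rot (rot p)) ≡ neg p
rot³≡neg (a , b) = cong₂ _,_ (first a b) (second a b)
  where
  first : ∀ a b → - (- b ℤ.+ (a ℤ.+ b)) ≡ - a
  first = solve-∀
  second : ∀ a b → - (a ℤ.+ b) ℤ.+ (- b ℤ.+ (a ℤ.+ b)) ≡ - b
  second = solve-∀

rotate-6 : ∀ p → rotate 6 p ≡ p
rotate-6 p = begin
  rot (rot (rot (rotate 3 p)))  ≡⟨ rot³≡neg (rotate 3 p) ⟩
  neg (rot (rot (rot p)))       ≡⟨ cong neg (rot³≡neg p) ⟩
  neg (neg p)                   ≡⟨ cong₂ _,_ (ℤ.neg-involutive (proj₁ p)) (ℤ.neg-involutive (proj₂ p)) ⟩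
  p                             ∎
  where open ≡-Reasoning

ρ : ℤ × ℤ → ℤ × ℤ
ρ (i , j) = (j , j ℤ.- i)

rot-toCentre : ∀ c → rot (toCentre c) ≡ toCentre (ρ c)
rot-toCentre (i , j) = cong₂ _,_ (first i j) (second i j)
  where
  first : ∀ i j → - (i ℤ.- + 2 ℤ.* j) ≡ j ℤ.+ (j ℤ.- i)
  first = solve-∀
  second : ∀ i j → (i ℤ.+ j) ℤ.+ (i ℤ.- + 2 ℤ.* j) ≡ j ℤ.- + 2 ℤ.* (j ℤ.- i)
  second = solve-∀

-- tilt is 3 j at toCentre (i , j), so its residue modulo 3 tells centres and the two kinds of corners apart
tilt : Pt → ℤ
tilt (a , b) = a ℤ.- b

tilt-corner : ∀ i j v → tilt (toCentre (i , j) ⊕ v) ≡ + 3 ℤ.* j ℤ.+ tilt v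
tilt-corner i j (x , y) = identity i j x y
  where
  identity : ∀ i j x y → ((i ℤ.+ j) ℤ.+ x) ℤ.- ((i ℤ.- + 2 ℤ.* j) ℤ.+ y) ≡ + 3 ℤ.* j ℤ.+ (x ℤ.- y)
  identity = solve-∀

3*n≢1 : ∀ n → 3 ℕ.* n ≢ 1
3*n≢1 zero ()
3*n≢1 (suc n) eq with trans (sym (ℕ.*-suc 3 n)) eq
... | ()

3*n≢2 : ∀ n → 3 ℕ.* n ≢ 2
3*n≢2 zero ()
3*n≢2 (suc n) eq with trans (sym (ℕ.*-suc 3 n)) eq
... | ()

corners-congruent : ∀ i j i′ j′ u v → toCentre (i , j) ⊕ u ≡ toCentre (i′ , j′) ⊕ v →
  + 3 ℤ.* (j ℤ.- j′) ≡ tilt v ℤ.- tilt u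
corners-congruent i j i′ j′ u v eq = begin
  + 3 ℤ.* (j ℤ.- j′)                                        ≡⟨ split j j′ (tilt u) (tilt v) ⟩
  (3j+u ℤ.- 3j′+v) ℤ.+ (tilt v ℤ.- tilt u)                  ≡⟨ cong (λ x → (x ℤ.- 3j′+v) ℤ.+ (tilt v ℤ.- tilt u)) tilts ⟩
  (3j′+v ℤ.- 3j′+v) ℤ.+ (tilt v ℤ.- tilt u)                 ≡⟨ cancel 3j′+v (tilt v ℤ.- tilt u) ⟩
  tilt v ℤ.- tilt u                                         ∎
  where
  open ≡-Reasoning
  3j+u = + 3 ℤ.* j ℤ.+ tilt u
  3j′+v = + 3 ℤ.* j′ ℤ.+ tilt v
  tilts : 3j+u ≡ 3j′+v
  tilts = trans (sym (tilt-corner i j u)) (trans (cong tilt eq) (tilt-corner i′ j′ v))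
  split : ∀ j j′ x y → + 3 ℤ.* (j ℤ.- j′) ≡ ((+ 3 ℤ.* j ℤ.+ x) ℤ.- (+ 3 ℤ.* j′ ℤ.+ y)) ℤ.+ (y ℤ.- x)
  split = solve-∀
  cancel : ∀ x y → (x ℤ.- x) ℤ.+ y ≡ y
  cancel = solve-∀

3∤ : ∀ x r → ∣ r ∣ ≡ 1 ⊎ ∣ r ∣ ≡ 2 → + 3 ℤ.* x ≢ r
3∤ x r ∣r∣∈12 eq with trans (sym (ℤ.abs-* (+ 3) x)) (cong ∣_∣ eq)
3∤ x r (inj₁ ∣r∣≡1) eq | 3∣x∣≡∣r∣ = 3*n≢1 ∣ x ∣ (trans 3∣x∣≡∣r∣ ∣r∣≡1)
3∤ x r (inj₂ ∣r∣≡2) eq | 3∣x∣≡∣r∣ = 3*n≢2 ∣ x ∣ (trans 3∣x∣≡∣r∣ ∣r∣≡2)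

shifted≢centre : ∀ c v c′ → ∣ tilt v ∣ ≡ 1 ⊎ ∣ tilt v ∣ ≡ 2 → toCentre c ⊕ v ≢ toCentre c′
shifted≢centre (i , j) v (i′ , j′) ∣tilt-v∣∈12 eq =
  3∤ (j ℤ.- j′) (+ 0 ℤ.- tilt v) (subst (λ n → n ≡ 1 ⊎ n ≡ 2) (sym ∣0-t∣≡∣t∣) ∣tilt-v∣∈12)
     (corners-congruent i j i′ j′ v 0ₚ (trans eq (sym (⊕-identityʳ _))))
  where
  ∣0-t∣≡∣t∣ : ∣ + 0 ℤ.- tilt v ∣ ≡ ∣ tilt v ∣
  ∣0-t∣≡∣t∣ = trans (cong ∣_∣ (ℤ.+-identityˡ (- tilt v))) (ℤ.∣-i∣≡∣i∣ (tilt v))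

toCentre-injective : ∀ {c c′} → toCentre c ≡ toCentre c′ → c ≡ c′
toCentre-injective {i , j} {i′ , j′} eq = cong₂ _,_ i≡i′ j≡j′
  where
  3j≡ : ∀ i j → + 3 ℤ.* j ≡ (i ℤ.+ j) ℤ.- (i ℤ.- + 2 ℤ.* j)
  3j≡ = solve-∀
  i≡ : ∀ i j → i ≡ (i ℤ.+ j) ℤ.- j
  i≡ = solve-∀
  j≡j′ : j ≡ j′
  j≡j′ = ℤ.*-cancelˡ-≡ (+ 3) j j′ (trans (3j≡ i j) (trans (cong₂ ℤ._-_ (cong proj₁ eq) (cong proj₂ eq)) (sym (3j≡ i′ j′))))
  i≡i′ : i ≡ i′
  i≡i′ = trans (i≡ i j) (trans (cong₂ ℤ._-_ (cong proj₁ eq) j≡j′) (sym (i≡ i′ j′)))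

rotate-suc′ : ∀ r p → rotate (suc r) p ≡ rotate r (rot p)
rotate-suc′ zero p = refl
rotate-suc′ (suc r) p = cong rot (rotate-suc′ r p)

rotate-+ : ∀ r d p → rotate (r ℕ.+ d) p ≡ rotate r (rotate d p)
rotate-+ zero d p = refl
rotate-+ (suc r) d p = cong rot (rotate-+ r d p)

rot-injective : ∀ {p q} → rot p ≡ rot q → p ≡ q
rot-injective {a , b} {c , d} eq = cong₂ _,_ a≡c b≡d
  where
  b≡d : b ≡ d
  b≡d = ℤ.neg-injective (cong proj₁ eq)
  a≡c : a ≡ c
  a≡c = +-cancelʳ b a c (trans (cong proj₂ eq) (cong (ℤ._+_ c) (sym b≡d)))

rotate-injective : ∀ r {p q} → rotate r p ≡ rotate r q → p ≡ q
rotate-injective zero eq = eq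
rotate-injective (suc r) eq = rotate-injective r (rot-injective eq)

-- InHex m: the hexagons of the benzenoid with suc m hexagons on each side, in centre-lattice coordinates
InHex : ℕ → ℤ × ℤ → Set
InHex m (i , j) = ∣ i ∣ ≤ m × ∣ j ∣ ≤ m × ∣ i ℤ.- j ∣ ≤ m

private
  2m+1≡1+[m+m] : ∀ m → 2 ℕ.* m ℕ.+ 1 ≡ suc (m ℕ.+ m)
  2m+1≡1+[m+m] = ℕ-Solver.solve-∀

∈-range⁻ : ∀ {m x} → x ∈ range m → ∣ x ∣ ≤ m
∈-range⁻ {m} x∈ with ∈-map⁻ (λ k → + k ℤ.- + m) x∈
... | k , k∈ , refl rewrite ℤ.[+m]-[+n]≡m⊖n k m with ℕ.≤-total k m
...   | inj₁ k≤m = subst (_≤ m) (sym (ℤ.∣⊖∣-≤ k≤m)) (ℕ.m∸n≤m m k)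
...   | inj₂ m≤k = subst (_≤ m) (sym (trans (ℤ.∣m⊖n∣≡∣n⊖m∣ k m) (ℤ.∣⊖∣-≤ m≤k)))
                     (ℕ.m≤n+o⇒m∸n≤o k m (ℕ.≤-pred (subst (k ℕ.<_) (2m+1≡1+[m+m] m) (∈-upTo⁻ k∈))))

∈-range⁺ : ∀ {m x} → ∣ x ∣ ≤ m → x ∈ range m
∈-range⁺ {m} {+ a} a≤m = subst (_∈ range m) (a+m-m≡a a m) (∈-map⁺ _ (∈-upTo⁺ a+m<2m+1))
  where
  a+m-m≡a : ∀ a m → + (a ℕ.+ m) ℤ.- + m ≡ + a
  a+m-m≡a a m = trans (cong (ℤ._- + m) (ℤ.pos-+ a m)) (cancel (+ a) (+ m))
    where
    cancel : ∀ x y → (x ℤ.+ y) ℤ.- y ≡ x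
    cancel = solve-∀
  a+m<2m+1 : a ℕ.+ m ℕ.< 2 ℕ.* m ℕ.+ 1
  a+m<2m+1 = subst (a ℕ.+ m ℕ.<_) (sym (2m+1≡1+[m+m] m)) (ℕ.s≤s (ℕ.+-monoˡ-≤ m a≤m))
∈-range⁺ {m} { -[1+ a ]} 1+a≤m = subst (_∈ range m) m-1-a-m≡-1-a (∈-map⁺ _ (∈-upTo⁺ m-1-a<2m+1))
  where
  m-1-a-m≡-1-a : + (m ℕ.∸ suc a) ℤ.- + m ≡ -[1+ a ]
  m-1-a-m≡-1-a = begin
    + (m ℕ.∸ suc a) ℤ.- + m        ≡⟨ ℤ.[+m]-[+n]≡m⊖n (m ℕ.∸ suc a) m ⟩
    (m ℕ.∸ suc a) ℤ.⊖ m            ≡⟨ ℤ.⊖-≤ (ℕ.m∸n≤m m (suc a)) ⟩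
    - + (m ℕ.∸ (m ℕ.∸ suc a))      ≡⟨ cong (λ n → - + n) (ℕ.m∸[m∸n]≡n 1+a≤m) ⟩
    -[1+ a ]                       ∎
    where open ≡-Reasoning
  m-1-a<2m+1 : m ℕ.∸ suc a ℕ.< 2 ℕ.* m ℕ.+ 1
  m-1-a<2m+1 = subst (m ℕ.∸ suc a ℕ.<_) (sym (2m+1≡1+[m+m] m)) (ℕ.s≤s (ℕ.≤-trans (ℕ.m∸n≤m m (suc a)) (ℕ.m≤m+n m m)))

∈-centres⁻ : ∀ {m p} → p ∈ centres (suc m) → Σ (ℤ × ℤ) λ c → InHex m c × toCentre c ≡ p
∈-centres⁻ {m} p∈ with ∈-map⁻ toCentre p∈
... | c@(i , j) , c∈ , refl with ∈-filter⁻ (λ ij → ∣ proj₁ ij ℤ.- proj₂ ij ∣ ≤? m) c∈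
...   | c∈range² , ∣i-j∣≤m with ∈-cartesianProduct⁻ (range m) (range m) c∈range²
...     | i∈ , j∈ = c , (∈-range⁻ i∈ , ∈-range⁻ j∈ , ∣i-j∣≤m) , refl

∈-centres⁺ : ∀ {m c} → InHex m c → toCentre c ∈ centres (suc m)
∈-centres⁺ {m} {i , j} (∣i∣≤m , ∣j∣≤m , ∣i-j∣≤m) =
  ∈-map⁺ toCentre (∈-filter⁺ (λ ij → ∣ proj₁ ij ℤ.- proj₂ ij ∣ ≤? m)
    (∈-cartesianProduct⁺ (∈-range⁺ {x = i} ∣i∣≤m) (∈-range⁺ {x = j} ∣j∣≤m)) ∣i-j∣≤m)

toCentre-∈-centres⁻ : ∀ {m c} → toCentre c ∈ centres (suc m) → InHex m c
toCentre-∈-centres⁻ {m} {c} c∈ with ∈-centres⁻ {m} {toCentre c} c∈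
... | c′ , c′∈ , eq = subst (InHex m) (toCentre-injective {c′} {c} eq) c′∈

InHex-ρ : ∀ {m} c → InHex m c → InHex m (ρ c)
InHex-ρ {m} (i , j) (∣i∣≤m , ∣j∣≤m , ∣i-j∣≤m) =
  ∣j∣≤m , subst (_≤ m) (ℤ.∣i-j∣≡∣j-i∣ i j) ∣i-j∣≤m , subst (λ x → ∣ x ∣ ≤ m) (sym (j-[j-i]≡i i j)) ∣i∣≤m
  where
  j-[j-i]≡i : ∀ i j → j ℤ.- (j ℤ.- i) ≡ i
  j-[j-i]≡i = solve-∀

rot-∈-centres : ∀ {m p} → p ∈ centres (suc m) → rot p ∈ centres (suc m)
rot-∈-centres {m} p∈ with ∈-centres⁻ {m} p∈
... | c , c∈ , refl = subst (_∈ centres (suc m)) (sym (rot-toCentre c)) (∈-centres⁺ {m} {ρ c} (InHex-ρ c c∈))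

rotate-∈-centres : ∀ {m} r {p} → p ∈ centres (suc m) → rotate r p ∈ centres (suc m)
rotate-∈-centres zero p∈ = p∈
rotate-∈-centres {m} (suc r) p∈ = rot-∈-centres {m} (rotate-∈-centres {m} r p∈)

rot-∈-centres⁻ : ∀ {m p} → rot p ∈ centres (suc m) → p ∈ centres (suc m)
rot-∈-centres⁻ {m} {p} rot-p∈ =
  subst (_∈ centres (suc m)) (trans (sym (rotate-suc′ 5 p)) (rotate-6 p)) (rotate-∈-centres {m} 5 rot-p∈)

InHex-ℕ : ∀ {m s t} → s ≤ m → t ≤ m → InHex m (+ s , + t)
InHex-ℕ {m} {s} {t} s≤m t≤m = s≤m , t≤m ,
  subst (_≤ m) (sym (cong ∣_∣ (ℤ.[+m]-[+n]≡m⊖n s t))) (ℕ.≤-trans (ℤ.∣m⊝n∣≤m⊔n s t) (ℕ.⊔-lub s≤m t≤m))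

not-InHex-beyond : ∀ {m c} → InHex m (+ m ℤ.+ + 1 , c) → ⊥
not-InHex-beyond {m} (m+1≤m , _) = ℕ.<-irrefl refl (subst (_≤ m) (ℕ.+-comm m 1) m+1≤m)

-- Degrees in the benzenoid

Incident : Pt → Pt × Pt → Set
Incident p f = (p ≡ proj₁ f) ⊎ (p ≡ proj₂ f)

incident? : ∀ p f → Dec (Incident p f)
incident? p f = (p ≟ₚ proj₁ f) ⊎-dec (p ≟ₚ proj₂ f)

sameEdge-sym : ∀ {e f} → SameEdge e f → SameEdge f e
sameEdge-sym (inj₁ (refl , refl)) = inj₁ (refl , refl)
sameEdge-sym (inj₂ (refl , refl)) = inj₂ (refl , refl)

sameEdge-trans : ∀ {e f g} → SameEdge e f → SameEdge f g → SameEdge e g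
sameEdge-trans (inj₁ (refl , refl)) f~g = f~g
sameEdge-trans (inj₂ (refl , refl)) (inj₁ (refl , refl)) = inj₂ (refl , refl)
sameEdge-trans (inj₂ (refl , refl)) (inj₂ (refl , refl)) = inj₁ (refl , refl)

sameEdge-isEquivalence : IsEquivalence SameEdge
sameEdge-isEquivalence = record { refl = inj₁ (refl , refl) ; sym = sameEdge-sym ; trans = sameEdge-trans }

edgeDecSetoid : DecSetoid _ _
edgeDecSetoid = record
  { Carrier = Pt × Pt ; _≈_ = SameEdge
  ; isDecEquivalence = record { isEquivalence = sameEdge-isEquivalence ; _≟_ = sameEdge? } }

sameEdge⇒incident : ∀ {f p q} → SameEdge f (p , q) → Incident p f
sameEdge⇒incident (inj₁ (refl , _)) = inj₁ refl
sameEdge⇒incident (inj₂ (_ , refl)) = inj₂ refl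

sameEdge-other-end : ∀ {f p q q′} → q ≢ p → SameEdge f (p , q) → SameEdge f (p , q′) → q ≡ q′
sameEdge-other-end _   (inj₁ (refl , refl)) (inj₁ (_ , refl))    = refl
sameEdge-other-end q≢p (inj₁ (refl , refl)) (inj₂ (refl , refl)) = ⊥-elim (q≢p refl)
sameEdge-other-end q≢p (inj₂ (refl , refl)) (inj₁ (refl , _))    = ⊥-elim (q≢p refl)
sameEdge-other-end _   (inj₂ (refl , refl)) (inj₂ (refl , _))    = refl

joins? : (p : Pt) (es : List (Pt × Pt)) (q : Pt) → Dec (Any (λ f → SameEdge f (p , q)) es)
joins? p es q = any? (λ f → sameEdge? f (p , q)) es

module _ (p : Pt) {qs : List Pt} (!qs : Unique qs) (p∉qs : p ∉ qs) where

  degree-by-neighbours : ∀ es → AllPairs (λ e f → ¬ SameEdge e f) es →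
    (∀ {f} → f ∈ es → Incident p f → Σ Pt λ q → q ∈ qs × SameEdge f (p , q)) →
    degree _≟ₚ_ es p ≡ count (joins? p es) qs
  degree-by-neighbours [] [] _ = sym (count-none (joins? p []) qs λ _ ())
  degree-by-neighbours (f ∷ es) (f≁es ∷ !es) neighbour = begin
    degree _≟ₚ_ (f ∷ es) p
      ≡⟨ count-∷ (incident? p) f es ⟩
    count (incident? p) [ f ] + degree _≟ₚ_ es p
      ≡⟨ cong₂ _+_ single (degree-by-neighbours es !es (neighbour ∘′ there)) ⟩
    count (λ q → sameEdge? f (p , q)) qs + count (joins? p es) qs
      ≡⟨ count-⊎ (λ q → sameEdge? f (p , q)) (joins? p es) qs disjoint ⟨
    count (λ q → sameEdge? f (p , q) ⊎-dec joins? p es q) qs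
      ≡⟨ count-cong _ (joins? p (f ∷ es)) qs (λ _ → [ here , there ]′) (λ _ → Any-∷⁻) ⟩
    count (joins? p (f ∷ es)) qs ∎
    where
    open ≡-Reasoning
    Any-∷⁻ : ∀ {q} → Any (λ g → SameEdge g (p , q)) (f ∷ es) → SameEdge f (p , q) ⊎ Any (λ g → SameEdge g (p , q)) es
    Any-∷⁻ (here f~pq) = inj₁ f~pq
    Any-∷⁻ (there g~pq) = inj₂ g~pq
    disjoint : ∀ {q} → q ∈ qs → SameEdge f (p , q) → ¬ Any (λ g → SameEdge g (p , q)) es
    disjoint _ f~pq g~pq with find g~pq
    ... | g , g∈es , g~pq′ = All.lookup f≁es g∈es (sameEdge-trans f~pq (sameEdge-sym g~pq′))
    single : count (incident? p) [ f ] ≡ count (λ q → sameEdge? f (p , q)) qs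
    single with incident? p f
    ... | yes p∈f with neighbour (here refl) p∈f
    ...   | q , q∈qs , f~pq = trans (count-yes (incident? p) [] p∈f)
      (sym (count-unique (λ q → sameEdge? f (p , q)) !qs q∈qs f~pq
             (λ _ f~pq′ → sym (sameEdge-other-end (λ { refl → p∉qs q∈qs }) f~pq f~pq′))))
    single | no p∉f = trans (count-no (incident? p) [] p∉f)
      (sym (count-none (λ q → sameEdge? f (p , q)) qs (λ _ f~pq → p∉f (sameEdge⇒incident f~pq))))

∈-hexEdges⁺ : ∀ c j → (c ⊕ δ j , c ⊕ δ (next j)) ∈ hexEdges c
∈-hexEdges⁺ c dir₀ = here refl
∈-hexEdges⁺ c dir₁ = there (here refl)
∈-hexEdges⁺ c dir₂ = there (there (here refl))
∈-hexEdges⁺ c dir₃ = there (there (there (here refl)))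
∈-hexEdges⁺ c dir₄ = there (there (there (there (here refl))))
∈-hexEdges⁺ c dir₅ = there (there (there (there (there (here refl)))))

∈-hexEdges⁻ : ∀ {c f} → f ∈ hexEdges c → Σ Dir λ j → f ≡ (c ⊕ δ j , c ⊕ δ (next j))
∈-hexEdges⁻ (here refl) = dir₀ , refl
∈-hexEdges⁻ (there (here refl)) = dir₁ , refl
∈-hexEdges⁻ (there (there (here refl))) = dir₂ , refl
∈-hexEdges⁻ (there (there (there (here refl)))) = dir₃ , refl
∈-hexEdges⁻ (there (there (there (there (here refl))))) = dir₄ , refl
∈-hexEdges⁻ (there (there (there (there (there (here refl)))))) = dir₅ , refl

hexEdges-towards⁻ : ∀ {c p k} → Any (λ f → SameEdge f (p , p ⊕ δ k)) (hexEdges c) →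
  (c ≡ p ⊕ δ (next k)) ⊎ (c ≡ p ⊕ δ (prev k))
hexEdges-towards⁻ {c} {p} {k} f~ with find f~
... | f , f∈ , f~pq with ∈-hexEdges⁻ {c} f∈
... | j , refl with f~pq
... | inj₁ (refl , e) = inj₁ (sym (subst (λ k → (c ⊕ δ j) ⊕ δ (next k) ≡ c) (sym k≡) (⊕-return c (δ-opposite j))))
  where
  k≡ : k ≡ next (next j)
  k≡ = δ-injective (⊕-cancelˡ (δ j) (⊕-cancelˡ c (begin
    c ⊕ (δ j ⊕ δ k)              ≡⟨ ⊕-assoc c (δ j) (δ k) ⟨
    (c ⊕ δ j) ⊕ δ k              ≡⟨ e ⟨
    c ⊕ δ (next j)               ≡⟨ cong (c ⊕_) (δ-between j) ⟨
    c ⊕ (δ j ⊕ δ (next (next j))) ∎)))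
    where open ≡-Reasoning
... | inj₂ (e , refl) = inj₂ (sym (subst (λ k → (c ⊕ δ (next j)) ⊕ δ (prev k) ≡ c) (sym k≡) (⊕-return c (δ-opposite-next j))))
  where
  k≡ : k ≡ prev j
  k≡ = δ-injective (⊕-cancelˡ (δ (next j)) (⊕-cancelˡ c (begin
    c ⊕ (δ (next j) ⊕ δ k)       ≡⟨ ⊕-assoc c (δ (next j)) (δ k) ⟨
    (c ⊕ δ (next j)) ⊕ δ k       ≡⟨ e ⟨
    c ⊕ δ j                      ≡⟨ cong (c ⊕_) (δ-between-prev j) ⟨
    c ⊕ (δ (next j) ⊕ δ (prev j)) ∎)))
    where open ≡-Reasoning

hexEdges-towards⁺ : ∀ {c p k} → (c ≡ p ⊕ δ (next k)) ⊎ (c ≡ p ⊕ δ (prev k)) →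
  Any (λ f → SameEdge f (p , p ⊕ δ k)) (hexEdges c)
hexEdges-towards⁺ {p = p} {k} (inj₁ refl) =
  lose (∈-hexEdges⁺ (p ⊕ δ (next k)) (prev (prev k)))
       (inj₁ (⊕-return p (δ-opposite-next k) ,
              trans (cong (λ j → (p ⊕ δ (next k)) ⊕ δ j) (next-prev (prev k))) (⊕-shift p (δ-between-prev k))))
hexEdges-towards⁺ {p = p} {k} (inj₂ refl) =
  lose (∈-hexEdges⁺ (p ⊕ δ (prev k)) (next k))
       (inj₂ (⊕-shift p (trans (⊕-comm (δ (prev k)) (δ (next k))) (δ-between-prev k)) , ⊕-return p (δ-opposite-prev k)))

deg : ℕ → Pt → ℕ
deg n = degree _≟ₚ_ (benzEdges n)

EdgeTowards : ℕ → Pt → Dir → Set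
EdgeTowards m p k = (p ⊕ δ (next k) ∈ centres (suc m)) ⊎ (p ⊕ δ (prev k) ∈ centres (suc m))

edgeTowards? : ∀ m p k → Dec (EdgeTowards m p k)
edgeTowards? m p k = (p ⊕ δ (next k) ∈? centres (suc m)) ⊎-dec (p ⊕ δ (prev k) ∈? centres (suc m))

hexEdges-at : ∀ {m f p} → f ∈ concatMap hexEdges (centres (suc m)) → Incident p f → Σ Dir λ k → SameEdge f (p , p ⊕ δ k)
hexEdges-at {m} f∈ p∈f with find (Any.concatMap⁻ hexEdges {xs = centres (suc m)} f∈)
... | c , _ , f∈hex with ∈-hexEdges⁻ {c} f∈hex | p∈f
...   | j , refl | inj₁ refl = next (next j) , inj₁ (refl , sym (⊕-shift c (δ-between j)))
...   | j , refl | inj₂ refl = prev j , inj₂ (sym (⊕-shift c (δ-between-prev j)) , refl)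

joins⇔edgeTowards : ∀ {m p k} → Any (λ f → SameEdge f (p , p ⊕ δ k)) (concatMap hexEdges (centres (suc m))) ⇔ EdgeTowards m p k
joins⇔edgeTowards {m} {p} {k} = mk⇔ to from
  where
  to : Any (λ f → SameEdge f (p , p ⊕ δ k)) (concatMap hexEdges (centres (suc m))) → EdgeTowards m p k
  to f~ with find (Any.concatMap⁻ hexEdges {xs = centres (suc m)} f~)
  ... | c , c∈ , f~′ with hexEdges-towards⁻ {c} {p} {k} f~′
  ...   | inj₁ refl = inj₁ c∈
  ...   | inj₂ refl = inj₂ c∈
  from : EdgeTowards m p k → Any (λ f → SameEdge f (p , p ⊕ δ k)) (concatMap hexEdges (centres (suc m)))
  from (inj₁ c∈) = Any.concatMap⁺ hexEdges (lose c∈ (hexEdges-towards⁺ {p ⊕ δ (next k)} {p} {k} (inj₁ refl)))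
  from (inj₂ c∈) = Any.concatMap⁺ hexEdges (lose c∈ (hexEdges-towards⁺ {p ⊕ δ (prev k)} {p} {k} (inj₂ refl)))

deg-formula : ∀ m p → deg (suc m) p ≡ count (edgeTowards? m p) allDirs
deg-formula m p = begin
  degree _≟ₚ_ edges p                                ≡⟨ degree-by-neighbours p !neighbours p∉neighbours edges
                                                          (UniqueSetoid.deduplicate-! edgeDecSetoid hexagonEdges) neighbour ⟩
  count (joins? p edges) neighbours                  ≡⟨ count-map (joins? p edges) (λ k → p ⊕ δ k) allDirs ⟩
  count (λ k → joins? p edges (p ⊕ δ k)) allDirs     ≡⟨ count-cong (λ k → joins? p edges (p ⊕ δ k)) (edgeTowards? m p) allDirs
        (λ {k} _ → Equivalence.to (joins⇔edgeTowards {m} {p} {k}) ∘′ Any.deduplicate⁻ sameEdge?)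
        (λ {k} _ → Any.deduplicate⁺ sameEdge? sameEdge-trans ∘′ Equivalence.from (joins⇔edgeTowards {m} {p} {k})) ⟩
  count (edgeTowards? m p) allDirs                   ∎
  where
  open ≡-Reasoning
  hexagonEdges = concatMap hexEdges (centres (suc m))
  edges = deduplicate sameEdge? hexagonEdges
  neighbours = map (λ k → p ⊕ δ k) allDirs
  !neighbours : Unique neighbours
  !neighbours = Unique.map⁺ (λ {j} {k} e → δ-injective {j} {k} (⊕-cancelˡ p e)) allDirs-unique
  p∉neighbours : p ∉ neighbours
  p∉neighbours p∈ with ∈-map⁻ (λ k → p ⊕ δ k) {xs = allDirs} p∈
  ... | k , _ , p≡p⊕δk = p⊕δ≢p p k (sym p≡p⊕δk)
  neighbour : ∀ {f} → f ∈ edges → Incident p f → Σ Pt λ q → q ∈ neighbours × SameEdge f (p , q)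
  neighbour f∈ p∈f with hexEdges-at {m} (∈-deduplicate⁻ sameEdge? hexagonEdges f∈) p∈f
  ... | k , f~ = p ⊕ δ k , ∈-map⁺ (λ k → p ⊕ δ k) (∈-allDirs k) , f~

edgeTowards-rot : ∀ {m p k} → EdgeTowards m (rot p) k ⇔ EdgeTowards m p (prev k)
edgeTowards-rot {m} {p} {k} = mk⇔ to from
  where
  cs = centres (suc m)
  next-side : rot p ⊕ δ (next k) ≡ rot (p ⊕ δ (next (prev k)))
  next-side = trans (cong (λ j → rot p ⊕ δ (next j)) (sym (next-prev k))) (sym (rot-corner p (next (prev k))))
  prev-side : rot p ⊕ δ (prev k) ≡ rot (p ⊕ δ (prev (prev k)))
  prev-side = trans (cong (λ j → rot p ⊕ δ j) (sym (next-prev (prev k)))) (sym (rot-corner p (prev (prev k))))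
  to : EdgeTowards m (rot p) k → EdgeTowards m p (prev k)
  to (inj₁ x∈) = inj₁ (rot-∈-centres⁻ {m} (subst (_∈ cs) next-side x∈))
  to (inj₂ x∈) = inj₂ (rot-∈-centres⁻ {m} (subst (_∈ cs) prev-side x∈))
  from : EdgeTowards m p (prev k) → EdgeTowards m (rot p) k
  from (inj₁ x∈) = inj₁ (subst (_∈ cs) (sym next-side) (rot-∈-centres {m} x∈))
  from (inj₂ x∈) = inj₂ (subst (_∈ cs) (sym prev-side) (rot-∈-centres {m} x∈))

map-prev-allDirs : map prev allDirs ↭ allDirs
map-prev-allDirs = ↭-sym (shift dir₅ (dir₀ ∷ dir₁ ∷ dir₂ ∷ dir₃ ∷ dir₄ ∷ []) [])

deg-rot : ∀ m p → deg (suc m) (rot p) ≡ deg (suc m) p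
deg-rot m p = begin
  deg (suc m) (rot p)                          ≡⟨ deg-formula m (rot p) ⟩
  count (edgeTowards? m (rot p)) allDirs          ≡⟨ count-cong (edgeTowards? m (rot p)) (λ k → edgeTowards? m p (prev k)) allDirs
      (λ {k} _ → Equivalence.to (edgeTowards-rot {m} {p} {k})) (λ {k} _ → Equivalence.from (edgeTowards-rot {m} {p} {k})) ⟩
  count (λ k → edgeTowards? m p (prev k)) allDirs ≡⟨ count-map (edgeTowards? m p) prev allDirs ⟨
  count (edgeTowards? m p) (map prev allDirs)     ≡⟨ count-↭ (edgeTowards? m p) map-prev-allDirs ⟩
  count (edgeTowards? m p) allDirs                ≡⟨ deg-formula m p ⟨
  deg (suc m) p                                ∎
  where open ≡-Reasoning

deg-rotate : ∀ m r p → deg (suc m) (rotate r p) ≡ deg (suc m) p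
deg-rotate m zero p = refl
deg-rotate m (suc r) p = trans (deg-rot m (rotate r p)) (deg-rotate m r p)

corner₀ : ℤ × ℤ → Pt
corner₀ c = toCentre c ⊕ δ₀

shifted∉centres : ∀ m c v → ∣ tilt v ∣ ≡ 1 ⊎ ∣ tilt v ∣ ≡ 2 → toCentre c ⊕ v ∉ centres (suc m)
shifted∉centres m c v ∣tilt-v∣∈12 x∈ with ∈-centres⁻ {m} x∈
... | c′ , _ , eq = shifted≢centre c v c′ ∣tilt-v∣∈12 (sym eq)

corner₀⊕δ₁ : ∀ i j → corner₀ (i , j) ⊕ δ₁ ≡ toCentre (i ℤ.+ + 1 , j)
corner₀⊕δ₁ i j = cong₂ _,_ (first i j) (second i j)
  where
  first : ∀ i j → ((i ℤ.+ j) ℤ.+ + 1) ℤ.+ + 0 ≡ (i ℤ.+ + 1) ℤ.+ j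
  first = solve-∀
  second : ∀ i j → ((i ℤ.- + 2 ℤ.* j) ℤ.+ + 0) ℤ.+ + 1 ≡ (i ℤ.+ + 1) ℤ.- + 2 ℤ.* j
  second = solve-∀

corner₀⊕δ₃ : ∀ c → corner₀ c ⊕ δ₃ ≡ toCentre c
corner₀⊕δ₃ c = ⊕-return (toCentre c) refl

corner₀⊕δ₅ : ∀ i j → corner₀ (i , j) ⊕ δ₅ ≡ toCentre (i ℤ.+ + 1 , j ℤ.+ + 1)
corner₀⊕δ₅ i j = cong₂ _,_ (first i j) (second i j)
  where
  first : ∀ i j → ((i ℤ.+ j) ℤ.+ + 1) ℤ.+ + 1 ≡ (i ℤ.+ + 1) ℤ.+ (j ℤ.+ + 1)
  first = solve-∀
  second : ∀ i j → ((i ℤ.- + 2 ℤ.* j) ℤ.+ + 0) ℤ.+ -[1+ 0 ] ≡ (i ℤ.+ + 1) ℤ.- + 2 ℤ.* (j ℤ.+ + 1)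
  second = solve-∀

deg-corner₀ : ∀ m c → InHex m c → deg (suc m) (corner₀ c) ≡ 2 + count (edgeTowards? m (corner₀ c)) [ dir₀ ]
deg-corner₀ m c c∈ = begin
  deg (suc m) p                                                  ≡⟨ deg-formula m p ⟩
  count (edgeTowards? m p) allDirs                                  ≡⟨ count-∷ (edgeTowards? m p) dir₀ _ ⟩
  count (edgeTowards? m p) [ dir₀ ] + count (edgeTowards? m p) others ≡⟨ cong (count (edgeTowards? m p) [ dir₀ ] ℕ.+_) others≡2 ⟩
  count (edgeTowards? m p) [ dir₀ ] + 2                           ≡⟨ ℕ.+-comm _ 2 ⟩
  2 + count (edgeTowards? m p) [ dir₀ ]                           ∎
  where
  open ≡-Reasoning
  p = corner₀ c
  others = dir₁ ∷ dir₂ ∷ dir₃ ∷ dir₄ ∷ dir₅ ∷ []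
  p⊕δ₃∈ : p ⊕ δ₃ ∈ centres (suc m)
  p⊕δ₃∈ = subst (_∈ centres (suc m)) (sym (corner₀⊕δ₃ c)) (∈-centres⁺ {m} {c} c∈)
  p⊕δ∉ : ∀ k → ∣ tilt (δ₀ ⊕ δ k) ∣ ≡ 1 ⊎ ∣ tilt (δ₀ ⊕ δ k) ∣ ≡ 2 → p ⊕ δ k ∉ centres (suc m)
  p⊕δ∉ k ∣tilt∣∈12 =
    subst (_∉ centres (suc m)) (sym (⊕-assoc (toCentre c) δ₀ (δ k))) (shifted∉centres m c (δ₀ ⊕ δ k) ∣tilt∣∈12)
  p⊕δ₀∉ = p⊕δ∉ dir₀ (inj₂ refl)
  p⊕δ₂∉ = p⊕δ∉ dir₂ (inj₁ refl)
  p⊕δ₄∉ = p⊕δ∉ dir₄ (inj₂ refl)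
  others≡2 : count (edgeTowards? m p) others ≡ 2
  others≡2 = trans (count-no (edgeTowards? m p) _ [ p⊕δ₂∉ , p⊕δ₀∉ ]′)
            (trans (count-yes (edgeTowards? m p) _ (inj₁ p⊕δ₃∈))
            (cong suc (trans (count-no (edgeTowards? m p) _ [ p⊕δ₄∉ , p⊕δ₂∉ ]′)
            (trans (count-yes (edgeTowards? m p) _ (inj₂ p⊕δ₃∈))
            (cong suc (count-no (edgeTowards? m p) _ [ p⊕δ₀∉ , p⊕δ₄∉ ]′))))))

deg-corner₀-interior : ∀ {m s t} → s < m → t ≤ m → deg (suc m) (corner₀ (+ s , + t)) ≡ 3
deg-corner₀-interior {m} {s} {t} s<m t≤m = trans (deg-corner₀ m (+ s , + t) (InHex-ℕ (ℕ.<⇒≤ s<m) t≤m))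
  (cong (2 ℕ.+_) (count-yes (edgeTowards? m (corner₀ (+ s , + t))) [] (inj₁ p⊕δ₁∈)))
  where
  p⊕δ₁∈ : corner₀ (+ s , + t) ⊕ δ₁ ∈ centres (suc m)
  p⊕δ₁∈ = subst (_∈ centres (suc m)) (sym (corner₀⊕δ₁ (+ s) (+ t)))
            (∈-centres⁺ {m} {+ s ℤ.+ + 1 , + t} (InHex-ℕ (subst (ℕ._≤ m) (ℕ.+-comm 1 s) s<m) t≤m))

deg-corner₀-boundary : ∀ {m t} → t ≤ m → deg (suc m) (corner₀ (+ m , + t)) ≡ 2
deg-corner₀-boundary {m} {t} t≤m = trans (deg-corner₀ m (+ m , + t) (InHex-ℕ ℕ.≤-refl t≤m))
  (cong (2 ℕ.+_) (count-no (edgeTowards? m (corner₀ (+ m , + t))) []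
    [ beyond {j = + t} (corner₀⊕δ₁ (+ m) (+ t)) , beyond {j = + t ℤ.+ + 1} (corner₀⊕δ₅ (+ m) (+ t)) ]′))
  where
  beyond : ∀ {x j} → x ≡ toCentre (+ m ℤ.+ + 1 , j) → x ∉ centres (suc m)
  beyond {j = j} refl x∈ = not-InHex-beyond {m} {j} (toCentre-∈-centres⁻ {m} {+ m ℤ.+ + 1 , j} x∈)

-- The six sectors of vertices

-[1+n]≡-n-1 : ∀ n → -[1+ n ] ≡ - (+ n) ℤ.- + 1
-[1+n]≡-n-1 n = trans (ℤ.neg-suc n) (pred≡ (- + n))
  where
  pred≡ : ∀ x → -[1+ 0 ] ℤ.+ x ≡ x ℤ.- + 1
  pred≡ = solve-∀

rotate-2-corner₀ : ∀ x y → rotate 2 (corner₀ (x , y)) ≡ corner₀ (y ℤ.- x ℤ.- + 1 , - x ℤ.- + 1)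
rotate-2-corner₀ x y = cong₂ _,_ (first x y) (second x y)
  where
  first : ∀ x y → - (((x ℤ.+ y) ℤ.+ + 1) ℤ.+ ((x ℤ.- + 2 ℤ.* y) ℤ.+ + 0))
                ≡ ((y ℤ.- x ℤ.- + 1) ℤ.+ (- x ℤ.- + 1)) ℤ.+ + 1
  first = solve-∀
  second : ∀ x y → - ((x ℤ.- + 2 ℤ.* y) ℤ.+ + 0) ℤ.+ (((x ℤ.+ y) ℤ.+ + 1) ℤ.+ ((x ℤ.- + 2 ℤ.* y) ℤ.+ + 0))
                 ≡ ((y ℤ.- x ℤ.- + 1) ℤ.- + 2 ℤ.* (- x ℤ.- + 1)) ℤ.+ + 0
  second = solve-∀

rotate-4-corner₀ : ∀ x y → rotate 4 (corner₀ (x , y)) ≡ corner₀ (- y ℤ.- + 1 , x ℤ.- y)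
rotate-4-corner₀ x y = begin
  rotate 2 (rotate 2 (corner₀ (x , y)))                        ≡⟨ cong (rotate 2) (rotate-2-corner₀ x y) ⟩
  rotate 2 (corner₀ (y ℤ.- x ℤ.- + 1 , - x ℤ.- + 1))           ≡⟨ rotate-2-corner₀ (y ℤ.- x ℤ.- + 1) (- x ℤ.- + 1) ⟩
  corner₀ ((- x ℤ.- + 1) ℤ.- (y ℤ.- x ℤ.- + 1) ℤ.- + 1 , - (y ℤ.- x ℤ.- + 1) ℤ.- + 1)
                                                               ≡⟨ cong corner₀ (cong₂ _,_ (first x y) (second x y)) ⟩
  corner₀ (- y ℤ.- + 1 , x ℤ.- y)                              ∎
  where
  open ≡-Reasoning
  first : ∀ x y → (- x ℤ.- + 1) ℤ.- (y ℤ.- x ℤ.- + 1) ℤ.- + 1 ≡ - y ℤ.- + 1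
  first = solve-∀
  second : ∀ x y → - (y ℤ.- x ℤ.- + 1) ℤ.- + 1 ≡ x ℤ.- y
  second = solve-∀

dirIndex : Dir → ℕ
dirIndex dir₀ = 0
dirIndex dir₁ = 1
dirIndex dir₂ = 2
dirIndex dir₃ = 3
dirIndex dir₄ = 4
dirIndex dir₅ = 5

sectorPoint : Dir × ℕ × ℕ → Pt
sectorPoint (k , s , t) = rotate (dirIndex k) (corner₀ (+ s , + t))

sectorIndices : ℕ → List (Dir × ℕ × ℕ)
sectorIndices n = cartesianProduct allDirs (cartesianProduct (upTo n) (upTo n))

sectorPoints : ℕ → List Pt
sectorPoints n = map sectorPoint (sectorIndices n)

∈-sectorIndices⁺ : ∀ {m} k {s t} → s ≤ m → t ≤ m → (k , s , t) ∈ sectorIndices (suc m)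
∈-sectorIndices⁺ k s≤m t≤m = ∈-cartesianProduct⁺ (∈-allDirs k) (∈-cartesianProduct⁺ (∈-upTo⁺ (s≤s s≤m)) (∈-upTo⁺ (s≤s t≤m)))

∈-sectorIndices⁻ : ∀ {m k s t} → (k , s , t) ∈ sectorIndices (suc m) → s ≤ m × t ≤ m
∈-sectorIndices⁻ {m} {k} {s} {t} kst∈ with ∈-cartesianProduct⁻ allDirs (cartesianProduct (upTo (suc m)) (upTo (suc m))) kst∈
... | _ , st∈ with ∈-cartesianProduct⁻ (upTo (suc m)) (upTo (suc m)) st∈
... | s∈ , t∈ = ℕ.≤-pred (∈-upTo⁻ s∈) , ℕ.≤-pred (∈-upTo⁻ t∈)

in-sector : ∀ {m p} k {s t} → s ≤ m → t ≤ m → p ≡ sectorPoint (k , s , t) → p ∈ sectorPoints (suc m)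
in-sector k s≤m t≤m refl = ∈-map⁺ sectorPoint (∈-sectorIndices⁺ k s≤m t≤m)

corner₀-sector₂ : ∀ s t → rotate 2 (corner₀ (+ s , + t)) ≡ corner₀ (+ t ℤ.- + s ℤ.- + 1 , -[1+ s ])
corner₀-sector₂ s t = trans (rotate-2-corner₀ (+ s) (+ t)) (cong (λ j → corner₀ (+ t ℤ.- + s ℤ.- + 1 , j)) (sym (-[1+n]≡-n-1 s)))

corner₀-sector₄ : ∀ s t → rotate 4 (corner₀ (+ s , + t)) ≡ corner₀ (-[1+ t ] , + s ℤ.- + t)
corner₀-sector₄ s t = trans (rotate-4-corner₀ (+ s) (+ t)) (cong (λ i → corner₀ (i , + s ℤ.- + t)) (sym (-[1+n]≡-n-1 t)))

-- The signs of the coordinates of c select sector 0, 2 or 4.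
corner₀-∈-sectorPoints : ∀ {m} c → InHex m c → corner₀ c ∈ sectorPoints (suc m)
corner₀-∈-sectorPoints (+ a , + b) (a≤m , b≤m , _) = in-sector dir₀ a≤m b≤m refl
corner₀-∈-sectorPoints (+ a , -[1+ b ]) (_ , 1+b≤m , a+1+b≤m) =
  in-sector dir₂ (ℕ.<⇒≤ 1+b≤m) a+1+b≤m (trans (cong (λ i → corner₀ (i , -[1+ b ])) a≡) (sym (corner₀-sector₂ b (a ℕ.+ suc b))))
  where
  a≡ : + a ≡ + (a ℕ.+ suc b) ℤ.- + b ℤ.- + 1
  a≡ = sym (trans (cong (λ x → x ℤ.- + b ℤ.- + 1) (trans (ℤ.pos-+ a (suc b)) (cong (ℤ._+_ (+ a)) (ℤ.pos-+ 1 b)))) (simplify (+ a) (+ b)))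
    where
    simplify : ∀ a b → (a ℤ.+ (+ 1 ℤ.+ b)) ℤ.- b ℤ.- + 1 ≡ a
    simplify = solve-∀
corner₀-∈-sectorPoints {m} (-[1+ a ] , + b) (1+a≤m , _ , ∣i-j∣≤m) =
  in-sector dir₄ a+b≤m (ℕ.<⇒≤ 1+a≤m) (trans (cong (λ j → corner₀ (-[1+ a ] , j)) b≡) (sym (corner₀-sector₄ (a ℕ.+ b) a)))
  where
  b≡ : + b ≡ + (a ℕ.+ b) ℤ.- + a
  b≡ = sym (trans (cong (ℤ._- + a) (ℤ.pos-+ a b)) (simplify (+ a) (+ b)))
    where
    simplify : ∀ a b → (a ℤ.+ b) ℤ.- a ≡ b
    simplify = solve-∀
  a+b≤m : a ℕ.+ b ≤ m
  a+b≤m = ℕ.<⇒≤ (subst (_≤ m) (trans (ℕ.+-suc b a) (cong suc (ℕ.+-comm b a))) (subst (_≤ m) (ℤ.∣i-j∣≡∣j-i∣ -[1+ a ] (+ b)) ∣i-j∣≤m))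
corner₀-∈-sectorPoints {m} (-[1+ a ] , -[1+ b ]) (1+a≤m , 1+b≤m , _) with a ℕ.≤? b
... | yes a≤b with ℕ.m≤n⇒∃[o]m+o≡n a≤b
...   | d , refl = in-sector dir₂ (ℕ.<⇒≤ 1+b≤m) (ℕ.≤-trans (ℕ.m≤n+m d a) (ℕ.<⇒≤ 1+b≤m))
  (trans (cong (λ i → corner₀ (i , -[1+ a ℕ.+ d ])) -1-a≡) (sym (corner₀-sector₂ (a ℕ.+ d) d)))
  where
  -1-a≡ : -[1+ a ] ≡ + d ℤ.- + (a ℕ.+ d) ℤ.- + 1
  -1-a≡ = trans (-[1+n]≡-n-1 a) (sym (trans (cong (λ x → + d ℤ.- x ℤ.- + 1) (ℤ.pos-+ a d)) (simplify (+ a) (+ d))))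
    where
    simplify : ∀ a d → d ℤ.- (a ℤ.+ d) ℤ.- + 1 ≡ - a ℤ.- + 1
    simplify = solve-∀
corner₀-∈-sectorPoints {m} (-[1+ a ] , -[1+ b ]) (1+a≤m , 1+b≤m , _) | no a≰b with ℕ.m≤n⇒∃[o]m+o≡n (ℕ.≰⇒> a≰b)
...   | d , refl = in-sector dir₄ (ℕ.≤-trans (ℕ.m≤n+m d (suc b)) (ℕ.<⇒≤ 1+a≤m)) (ℕ.<⇒≤ 1+a≤m)
  (trans (cong (λ j → corner₀ (-[1+ suc b ℕ.+ d ] , j)) -1-b≡) (sym (corner₀-sector₄ d (suc b ℕ.+ d))))
  where
  -1-b≡ : -[1+ b ] ≡ + d ℤ.- + (suc b ℕ.+ d)
  -1-b≡ = trans (-[1+n]≡-n-1 b) (sym (trans (cong (λ x → + d ℤ.- x) (trans (ℤ.pos-+ (suc b) d) (cong (ℤ._+ + d) (ℤ.pos-+ 1 b))))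
                                            (simplify (+ b) (+ d))))
    where
    simplify : ∀ b d → d ℤ.- ((+ 1 ℤ.+ b) ℤ.+ d) ≡ - b ℤ.- + 1
    simplify = solve-∀

rot-sectorPoint : ∀ k s t → rot (sectorPoint (k , s , t)) ≡ sectorPoint (next k , s , t)
rot-sectorPoint dir₀ s t = refl
rot-sectorPoint dir₁ s t = refl
rot-sectorPoint dir₂ s t = refl
rot-sectorPoint dir₃ s t = refl
rot-sectorPoint dir₄ s t = refl
rot-sectorPoint dir₅ s t = rotate-6 (corner₀ (+ s , + t))

rot-∈-sectorPoints : ∀ {m p} → p ∈ sectorPoints (suc m) → rot p ∈ sectorPoints (suc m)
rot-∈-sectorPoints {m} p∈ with ∈-map⁻ sectorPoint p∈
... | (k , s , t) , kst∈ , refl with ∈-sectorIndices⁻ {m} kst∈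
... | s≤m , t≤m = in-sector (next k) s≤m t≤m (rot-sectorPoint k s t)

∈-corners⁺ : ∀ c k → c ⊕ δ k ∈ corners c
∈-corners⁺ c dir₀ = here refl
∈-corners⁺ c dir₁ = there (here refl)
∈-corners⁺ c dir₂ = there (there (here refl))
∈-corners⁺ c dir₃ = there (there (there (here refl)))
∈-corners⁺ c dir₄ = there (there (there (there (here refl))))
∈-corners⁺ c dir₅ = there (there (there (there (there (here refl)))))

∈-corners⁻ : ∀ {c p} → p ∈ corners c → Σ Dir λ k → p ≡ c ⊕ δ k
∈-corners⁻ (here refl) = dir₀ , refl
∈-corners⁻ (there (here refl)) = dir₁ , refl
∈-corners⁻ (there (there (here refl))) = dir₂ , refl
∈-corners⁻ (there (there (there (here refl)))) = dir₃ , refl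
∈-corners⁻ (there (there (there (there (here refl))))) = dir₄ , refl
∈-corners⁻ (there (there (there (there (there (here refl)))))) = dir₅ , refl

∈-benzVerts⁺ : ∀ {n c} k → c ∈ centres n → c ⊕ δ k ∈ benzVerts n
∈-benzVerts⁺ {c = c} k c∈ = ∈-deduplicate⁺ _≟ₚ_ (Any.concatMap⁺ corners (lose c∈ (∈-corners⁺ c k)))

∈-benzVerts⁻ : ∀ {n p} → p ∈ benzVerts n → Σ Pt λ c → Σ Dir λ k → c ∈ centres n × p ≡ c ⊕ δ k
∈-benzVerts⁻ {n} p∈ with find (Any.concatMap⁻ corners {xs = centres n} (∈-deduplicate⁻ _≟ₚ_ (concatMap corners (centres n)) p∈))
... | c , c∈ , p∈corners with ∈-corners⁻ {c} p∈corners
... | k , p≡ = c , k , c∈ , p≡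

rot-∈-benzVerts : ∀ {m p} → p ∈ benzVerts (suc m) → rot p ∈ benzVerts (suc m)
rot-∈-benzVerts {m} p∈ with ∈-benzVerts⁻ {suc m} p∈
... | c , k , c∈ , refl = subst (_∈ benzVerts (suc m)) (sym (rot-corner c k)) (∈-benzVerts⁺ {suc m} (next k) (rot-∈-centres {m} c∈))

rotate-∈-benzVerts : ∀ {m} r {p} → p ∈ benzVerts (suc m) → rotate r p ∈ benzVerts (suc m)
rotate-∈-benzVerts zero p∈ = p∈
rotate-∈-benzVerts {m} (suc r) p∈ = rot-∈-benzVerts {m} (rotate-∈-benzVerts {m} r p∈)

sectorPoints⊆benzVerts : ∀ {m p} → p ∈ sectorPoints (suc m) → p ∈ benzVerts (suc m)
sectorPoints⊆benzVerts {m} p∈ with ∈-map⁻ sectorPoint p∈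
... | (k , s , t) , kst∈ , refl with ∈-sectorIndices⁻ {m} kst∈
... | s≤m , t≤m = rotate-∈-benzVerts {m} (dirIndex k) (∈-benzVerts⁺ {suc m} dir₀ (∈-centres⁺ {m} {+ s , + t} (InHex-ℕ s≤m t≤m)))

-- Corner (next k) of a hexagon is the rotation of corner k of the hexagon rotated back by five sixths of a turn.
benzVerts⊆sectorPoints : ∀ {m p} → p ∈ benzVerts (suc m) → p ∈ sectorPoints (suc m)
benzVerts⊆sectorPoints {m} p∈ with ∈-benzVerts⁻ {suc m} p∈
... | c , k , c∈ , refl = corner k c∈
  where
  CornersIn : Dir → Set
  CornersIn k = ∀ {c} → c ∈ centres (suc m) → c ⊕ δ k ∈ sectorPoints (suc m)
  corner₀-in : CornersIn dir₀
  corner₀-in c∈ with ∈-centres⁻ {m} c∈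
  ... | c′ , c′∈ , refl = corner₀-∈-sectorPoints c′ c′∈
  step : ∀ k → CornersIn k → CornersIn (next k)
  step k in-k {c} c∈ = subst (_∈ sectorPoints (suc m)) unrotate (rot-∈-sectorPoints {m} (in-k (rotate-∈-centres {m} 5 c∈)))
    where
    unrotate : rot (rotate 5 c ⊕ δ k) ≡ c ⊕ δ (next k)
    unrotate = trans (rot-corner (rotate 5 c) k) (cong (_⊕ δ (next k)) (rotate-6 c))
  corner : ∀ k → CornersIn k
  corner dir₀ = corner₀-in
  corner dir₁ = step dir₀ corner₀-in
  corner dir₂ = step dir₁ (step dir₀ corner₀-in)
  corner dir₃ = step dir₂ (step dir₁ (step dir₀ corner₀-in))
  corner dir₄ = step dir₃ (step dir₂ (step dir₁ (step dir₀ corner₀-in)))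
  corner dir₅ = step dir₄ (step dir₃ (step dir₂ (step dir₁ (step dir₀ corner₀-in))))

rotateDir : ℕ → Dir → Dir
rotateDir zero k = k
rotateDir (suc r) k = next (rotateDir r k)

rotate-corner : ∀ r c k → Σ (ℤ × ℤ) λ c′ → rotate r (toCentre c ⊕ δ k) ≡ toCentre c′ ⊕ δ (rotateDir r k)
rotate-corner zero c k = c , refl
rotate-corner (suc r) c k with rotate-corner r c k
... | c′ , eq = ρ c′ , trans (cong rot eq) (trans (rot-corner (toCentre c′) (rotateDir r k)) (cong (_⊕ δ (rotateDir (suc r) k)) (rot-toCentre c′)))

corner₀-injective : ∀ {c c′} → corner₀ c ≡ corner₀ c′ → c ≡ c′
corner₀-injective {c} {c′} eq =
  toCentre-injective {c} {c′} (⊕-cancelˡ δ₀ (trans (⊕-comm δ₀ (toCentre c)) (trans eq (⊕-comm (toCentre c′) δ₀))))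

corner₀≢corner : ∀ c c′ k → ∣ tilt (δ k) ℤ.- tilt δ₀ ∣ ≡ 1 ⊎ ∣ tilt (δ k) ℤ.- tilt δ₀ ∣ ≡ 2 → corner₀ c ≢ toCentre c′ ⊕ δ k
corner₀≢corner (i , j) (i′ , j′) k residue eq = 3∤ (j ℤ.- j′) _ residue (corners-congruent i j i′ j′ δ₀ (δ k) eq)

corner₀≢odd-rotation : ∀ r {s t s′ t′} →
  ∣ tilt (δ (rotateDir r dir₀)) ℤ.- tilt δ₀ ∣ ≡ 1 ⊎ ∣ tilt (δ (rotateDir r dir₀)) ℤ.- tilt δ₀ ∣ ≡ 2 →
  corner₀ (+ s , + t) ≢ rotate r (corner₀ (+ s′ , + t′))
corner₀≢odd-rotation r {s} {t} {s′} {t′} residue eq =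
  corner₀≢corner (+ s , + t) (proj₁ rotated) (rotateDir r dir₀) residue (trans eq (proj₂ rotated))
  where rotated = rotate-corner r (+ s′ , + t′) dir₀

+≢-[1+] : ∀ {a b} → + a ≢ -[1+ b ]
+≢-[1+] ()

-- Odd rotations change the residue of tilt modulo 3, and the rotations by a third and by two thirds of a turn
-- make a coordinate of corner₀ negative.
corner₀≡rotate : ∀ d {s t s′ t′} → d < 6 → corner₀ (+ s , + t) ≡ rotate d (corner₀ (+ s′ , + t′)) → d ≡ 0 × s ≡ s′ × t ≡ t′
corner₀≡rotate 0 {s} {t} {s′} {t′} _ eq with corner₀-injective {+ s , + t} {+ s′ , + t′} eq
... | refl = refl , refl , refl
corner₀≡rotate 1 {s} {t} {s′} {t′} _ eq = ⊥-elim (corner₀≢odd-rotation 1 {s} {t} {s′} {t′} (inj₂ refl) eq)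
corner₀≡rotate 2 {s} {t} {s′} {t′} _ eq =
  ⊥-elim (+≢-[1+] (cong proj₂ (corner₀-injective {+ s , + t} {+ t′ ℤ.- + s′ ℤ.- + 1 , -[1+ s′ ]} (trans eq (corner₀-sector₂ s′ t′)))))
corner₀≡rotate 3 {s} {t} {s′} {t′} _ eq = ⊥-elim (corner₀≢odd-rotation 3 {s} {t} {s′} {t′} (inj₂ refl) eq)
corner₀≡rotate 4 {s} {t} {s′} {t′} _ eq =
  ⊥-elim (+≢-[1+] (cong proj₁ (corner₀-injective {+ s , + t} { -[1+ t′ ] , + s′ ℤ.- + t′ } (trans eq (corner₀-sector₄ s′ t′)))))
corner₀≡rotate 5 {s} {t} {s′} {t′} _ eq = ⊥-elim (corner₀≢odd-rotation 5 {s} {t} {s′} {t′} (inj₁ refl) eq)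
corner₀≡rotate (suc (suc (suc (suc (suc (suc _)))))) (s≤s (s≤s (s≤s (s≤s (s≤s (s≤s ()))))))

dirFromIndex : ℕ → Dir
dirFromIndex 1 = dir₁
dirFromIndex 2 = dir₂
dirFromIndex 3 = dir₃
dirFromIndex 4 = dir₄
dirFromIndex 5 = dir₅
dirFromIndex _ = dir₀

dirFromIndex-dirIndex : ∀ k → dirFromIndex (dirIndex k) ≡ k
dirFromIndex-dirIndex dir₀ = refl
dirFromIndex-dirIndex dir₁ = refl
dirFromIndex-dirIndex dir₂ = refl
dirFromIndex-dirIndex dir₃ = refl
dirFromIndex-dirIndex dir₄ = refl
dirFromIndex-dirIndex dir₅ = refl

dirIndex<6 : ∀ k → dirIndex k < 6
dirIndex<6 dir₀ = s≤s z≤n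
dirIndex<6 dir₁ = s≤s (s≤s z≤n)
dirIndex<6 dir₂ = s≤s (s≤s (s≤s z≤n))
dirIndex<6 dir₃ = s≤s (s≤s (s≤s (s≤s z≤n)))
dirIndex<6 dir₄ = s≤s (s≤s (s≤s (s≤s (s≤s z≤n))))
dirIndex<6 dir₅ = s≤s (s≤s (s≤s (s≤s (s≤s (s≤s z≤n)))))

dirIndex-injective : ∀ {j k} → dirIndex j ≡ dirIndex k → j ≡ k
dirIndex-injective {j} {k} eq = trans (sym (dirFromIndex-dirIndex j)) (trans (cong dirFromIndex eq) (dirFromIndex-dirIndex k))

rotate-offset : ∀ r d {r′ p q} → r ℕ.+ d ≡ r′ → rotate r p ≡ rotate r′ q → p ≡ rotate d q
rotate-offset r d {q = q} refl eq = rotate-injective r (trans eq (rotate-+ r d q))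

sectorPoint-injective-≤ : ∀ {k s t k′ s′ t′} → dirIndex k ≤ dirIndex k′ →
  sectorPoint (k , s , t) ≡ sectorPoint (k′ , s′ , t′) → (k , s , t) ≡ (k′ , s′ , t′)
sectorPoint-injective-≤ {k} {s} {t} {k′} {s′} {t′} k≤k′ eq with ℕ.m≤n⇒∃[o]m+o≡n k≤k′
... | d , k+d≡k′ with corner₀≡rotate d {s} {t} {s′} {t′} (ℕ.m+n≤o⇒n≤o (dirIndex k) (subst (_≤ 6) (sym (trans (ℕ.+-suc _ d) (cong suc k+d≡k′))) (dirIndex<6 k′)))
                                       (rotate-offset (dirIndex k) d k+d≡k′ eq)
... | refl , refl , refl = cong (_, s , t) (dirIndex-injective (trans (sym (ℕ.+-identityʳ _)) k+d≡k′))

sectorPoint-injective : ∀ {x y} → sectorPoint x ≡ sectorPoint y → x ≡ y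
sectorPoint-injective {k , _ , _} {k′ , _ , _} eq with ℕ.≤-total (dirIndex k) (dirIndex k′)
... | inj₁ k≤k′ = sectorPoint-injective-≤ k≤k′ eq
... | inj₂ k′≤k = sym (sectorPoint-injective-≤ k′≤k (sym eq))

sectorPoints-unique : ∀ n → Unique (sectorPoints n)
sectorPoints-unique n = Unique.map⁺ sectorPoint-injective
  (Unique.cartesianProduct⁺ allDirs-unique (Unique.cartesianProduct⁺ (Unique.upTo⁺ n) (Unique.upTo⁺ n)))

benzVerts↭sectorPoints : ∀ m → benzVerts (suc m) ↭ sectorPoints (suc m)
benzVerts↭sectorPoints m = ∼bag⇒↭ (unique∧set⇒bag (deduplicate-! _) (sectorPoints-unique (suc m))
  (mk⇔ (benzVerts⊆sectorPoints {m}) (sectorPoints⊆benzVerts {m})))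

deg-sectorPoint-interior : ∀ {m k s t} → s < m → t ≤ m → deg (suc m) (sectorPoint (k , s , t)) ≡ 3
deg-sectorPoint-interior {m} {k} {s} {t} s<m t≤m = trans (deg-rotate m (dirIndex k) _) (deg-corner₀-interior s<m t≤m)

deg-sectorPoint-boundary : ∀ {m k t} → t ≤ m → deg (suc m) (sectorPoint (k , m , t)) ≡ 2
deg-sectorPoint-boundary {m} {k} t≤m = trans (deg-rotate m (dirIndex k) _) (deg-corner₀-boundary t≤m)

deg-benzVerts : ∀ {m p} → p ∈ benzVerts (suc m) → deg (suc m) p ≡ 2 ⊎ deg (suc m) p ≡ 3
deg-benzVerts {m} p∈ with ∈-map⁻ sectorPoint (benzVerts⊆sectorPoints {m} p∈)
... | (k , s , t) , kst∈ , refl with ∈-sectorIndices⁻ {m} kst∈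
... | s≤m , t≤m with ℕ.m≤n⇒m<n∨m≡n s≤m
...   | inj₁ s<m = inj₂ (deg-sectorPoint-interior s<m t≤m)
...   | inj₂ refl = inj₁ (deg-sectorPoint-boundary t≤m)

length-benzVerts : ∀ m → length (benzVerts (suc m)) ≡ 6 * suc m ^ 2
length-benzVerts m = begin
  length (benzVerts (suc m))          ≡⟨ ↭-length (benzVerts↭sectorPoints m) ⟩
  length (sectorPoints (suc m))       ≡⟨ length-map sectorPoint (sectorIndices (suc m)) ⟩
  length (sectorIndices (suc m))      ≡⟨ length-cartesianProduct allDirs (cartesianProduct (upTo (suc m)) (upTo (suc m))) ⟩
  6 * length (cartesianProduct (upTo (suc m)) (upTo (suc m)))
    ≡⟨ cong (6 *_) (trans (length-cartesianProduct (upTo (suc m)) (upTo (suc m)))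
                          (cong₂ _*_ (length-upTo (suc m)) (length-upTo (suc m)))) ⟩
  6 * (suc m * suc m)                 ≡⟨ cong (λ x → 6 * (suc m * x)) (ℕ.*-identityʳ (suc m)) ⟨
  6 * suc m ^ 2                       ∎
  where open ≡-Reasoning

3≢2 : 3 ≢ 2
3≢2 ()

length-deg2 : ∀ m → length (deg2 (suc m)) ≡ 6 * suc m
length-deg2 m = begin
  count (λ p → deg (suc m) p ≟ 2) (benzVerts (suc m))
    ≡⟨ count-↭ (λ p → deg (suc m) p ≟ 2) (benzVerts↭sectorPoints m) ⟩
  count (λ p → deg (suc m) p ≟ 2) (sectorPoints (suc m))
    ≡⟨ count-map (λ p → deg (suc m) p ≟ 2) sectorPoint (sectorIndices (suc m)) ⟩
  count (λ x → deg (suc m) (sectorPoint x) ≟ 2) (sectorIndices (suc m))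
    ≡⟨ count-cong (λ x → deg (suc m) (sectorPoint x) ≟ 2) (λ x → proj₁ (proj₂ x) ≟ m) (sectorIndices (suc m))
                  deg2⇒boundary boundary⇒deg2 ⟩
  count (λ x → proj₁ (proj₂ x) ≟ m) (sectorIndices (suc m))
    ≡⟨ count-cartesianProduct-proj₂ (λ st → proj₁ st ≟ m) allDirs (cartesianProduct (upTo (suc m)) (upTo (suc m))) ⟩
  6 * count (λ st → proj₁ st ≟ m) (cartesianProduct (upTo (suc m)) (upTo (suc m)))
    ≡⟨ cong (6 *_) (count-cartesianProduct-proj₁ (_≟ m) (upTo (suc m)) (upTo (suc m))) ⟩
  6 * (count (_≟ m) (upTo (suc m)) * length (upTo (suc m)))
    ≡⟨ cong (6 *_) (cong₂ _*_ one-boundary-row (length-upTo (suc m))) ⟩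
  6 * (1 * suc m)
    ≡⟨ cong (6 *_) (ℕ.*-identityˡ (suc m)) ⟩
  6 * suc m ∎
  where
  open ≡-Reasoning
  one-boundary-row : count (_≟ m) (upTo (suc m)) ≡ 1
  one-boundary-row = count-unique (_≟ m) (Unique.upTo⁺ (suc m)) (∈-upTo⁺ ℕ.≤-refl) refl (λ _ s≡m → s≡m)
  deg2⇒boundary : ∀ {x} → x ∈ sectorIndices (suc m) → deg (suc m) (sectorPoint x) ≡ 2 → proj₁ (proj₂ x) ≡ m
  deg2⇒boundary {k , s , t} x∈ deg≡2 with ∈-sectorIndices⁻ {m} x∈
  ... | s≤m , t≤m with ℕ.m≤n⇒m<n∨m≡n s≤m
  ...   | inj₂ s≡m = s≡m
  ...   | inj₁ s<m = ⊥-elim (3≢2 (trans (sym (deg-sectorPoint-interior s<m t≤m)) deg≡2))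
  boundary⇒deg2 : ∀ {x} → x ∈ sectorIndices (suc m) → proj₁ (proj₂ x) ≡ m → deg (suc m) (sectorPoint x) ≡ 2
  boundary⇒deg2 {k , s , t} x∈ refl = deg-sectorPoint-boundary (proj₂ (∈-sectorIndices⁻ {m} x∈))

-- Degrees and edge counts of PAH_n

benzEdges-valid : ∀ {m e} → e ∈ benzEdges (suc m) →
  proj₁ e ≢ proj₂ e × proj₁ e ∈ benzVerts (suc m) × proj₂ e ∈ benzVerts (suc m)
benzEdges-valid {m} e∈ with find (Any.concatMap⁻ hexEdges {xs = centres (suc m)} (∈-deduplicate⁻ sameEdge? _ e∈))
... | c , c∈ , e∈hex with ∈-hexEdges⁻ {c} e∈hex
... | j , refl = (λ eq → next≢ j (δ-injective (⊕-cancelˡ c eq))) , ∈-benzVerts⁺ {suc m} j c∈ , ∈-benzVerts⁺ {suc m} (next j) c∈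
  where
  next≢ : ∀ j → j ≢ next j
  next≢ dir₀ ()
  next≢ dir₁ ()
  next≢ dir₂ ()
  next≢ dir₃ ()
  next≢ dir₄ ()
  next≢ dir₅ ()

deg2-unique : ∀ n → Unique (deg2 n)
deg2-unique n = Unique.filter⁺ (λ p → deg n p ≟ 2) (deduplicate-! (concatMap corners (centres n)))

benzenoid-handshake : ∀ m → 2 * length (benzEdges (suc m)) + length (deg2 (suc m)) ≡ 3 * length (benzVerts (suc m))
benzenoid-handshake m = begin
  2 * length (benzEdges n) + count leaf? V
    ≡⟨ cong₂ _+_ (handshake _≟ₚ_ (deduplicate-! (concatMap corners (centres n))) (benzEdges n) (benzEdges-valid {m}))
                 (sym (count≡sum leaf? V)) ⟨
  sum (map (deg n) V) + sum (map (λ v → count leaf? [ v ]) V)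
    ≡⟨ sum-map-+ (deg n) (λ v → count leaf? [ v ]) V ⟨
  sum (map (λ v → deg n v + count leaf? [ v ]) V)
    ≡⟨ sum-map-const _ 3 V (λ v∈ → [ deg2+1 , deg3+0 ]′ (deg-benzVerts {m} v∈)) ⟩
  3 * length V ∎
  where
  open ≡-Reasoning
  n = suc m
  V = benzVerts n
  leaf? = λ p → deg n p ≟ 2
  deg2+1 : ∀ {v} → deg n v ≡ 2 → deg n v + count leaf? [ v ] ≡ 3
  deg2+1 deg≡2 = cong₂ _+_ deg≡2 (count-yes leaf? [] deg≡2)
  deg3+0 : ∀ {v} → deg n v ≡ 3 → deg n v + count leaf? [ v ] ≡ 3
  deg3+0 deg≡3 = cong₂ _+_ deg≡3 (count-no leaf? [] (λ deg≡2 → 3≢2 (trans (sym deg≡3) deg≡2)))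

lattice-edge : Pt × Pt → Vtx × Vtx
lattice-edge e = (inj₁ (proj₁ e) , inj₁ (proj₂ e))

leaf-edge : Pt → Vtx × Vtx
leaf-edge q = (inj₁ q , inj₂ q)

pah-incident? : ∀ x (e : Vtx × Vtx) → Dec ((x ≡ proj₁ e) ⊎ (x ≡ proj₂ e))
pah-incident? x e = (x ≟ᵥ proj₁ e) ⊎-dec (x ≟ᵥ proj₂ e)

d-split : ∀ n x → d n x ≡ count (pah-incident? x ∘ lattice-edge) (benzEdges n) + count (pah-incident? x ∘ leaf-edge) (deg2 n)
d-split n x = trans (count-++ (pah-incident? x) (map lattice-edge (benzEdges n)) (map leaf-edge (deg2 n)))
                    (cong₂ _+_ (count-map (pah-incident? x) lattice-edge (benzEdges n)) (count-map (pah-incident? x) leaf-edge (deg2 n)))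

d-lattice-vertex : ∀ {m p} → p ∈ benzVerts (suc m) → d (suc m) (inj₁ p) ≡ 3
d-lattice-vertex {m} {p} p∈ = begin
  d n (inj₁ p)
    ≡⟨ d-split n (inj₁ p) ⟩
  count (pah-incident? (inj₁ p) ∘ lattice-edge) (benzEdges n) + count (pah-incident? (inj₁ p) ∘ leaf-edge) (deg2 n)
    ≡⟨ cong₂ _+_ (count-cong (pah-incident? (inj₁ p) ∘ lattice-edge) (incident? p) (benzEdges n)
                   (λ _ → Data.Sum.map Sum.inj₁-injective Sum.inj₁-injective) (λ _ → Data.Sum.map (cong inj₁) (cong inj₁)))
                 (count-cong (pah-incident? (inj₁ p) ∘ leaf-edge) (p ≟ₚ_) (deg2 n)
                   (λ _ → [ Sum.inj₁-injective , (λ ()) ]′) (λ _ → inj₁ ∘′ cong inj₁)) ⟩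
  deg n p + count (p ≟ₚ_) (deg2 n)
    ≡⟨ [ leaf , inner ]′ (deg-benzVerts {m} p∈) ⟩
  3 ∎
  where
  open ≡-Reasoning
  n = suc m
  leaf : deg n p ≡ 2 → deg n p + count (p ≟ₚ_) (deg2 n) ≡ 3
  leaf deg≡2 = cong₂ _+_ deg≡2
    (count-unique (p ≟ₚ_) (deg2-unique n) (∈-filter⁺ (λ q → deg n q ≟ 2) p∈ deg≡2) refl (λ _ → sym))
  inner : deg n p ≡ 3 → deg n p + count (p ≟ₚ_) (deg2 n) ≡ 3
  inner deg≡3 = cong₂ _+_ deg≡3 (count-none (p ≟ₚ_) (deg2 n) not-leaf)
    where
    not-leaf : ∀ {q} → q ∈ deg2 n → p ≢ q
    not-leaf q∈ refl = 3≢2 (trans (sym deg≡3) (proj₂ (∈-filter⁻ (λ q → deg n q ≟ 2) {xs = benzVerts n} q∈)))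

d-leaf : ∀ {m p} → p ∈ deg2 (suc m) → d (suc m) (inj₂ p) ≡ 1
d-leaf {m} {p} p∈ = begin
  d n (inj₂ p)
    ≡⟨ d-split n (inj₂ p) ⟩
  count (pah-incident? (inj₂ p) ∘ lattice-edge) (benzEdges n) + count (pah-incident? (inj₂ p) ∘ leaf-edge) (deg2 n)
    ≡⟨ cong₂ _+_ (count-none (pah-incident? (inj₂ p) ∘ lattice-edge) (benzEdges n) (λ _ → [ (λ ()) , (λ ()) ]′))
                 (count-cong (pah-incident? (inj₂ p) ∘ leaf-edge) (p ≟ₚ_) (deg2 n)
                   (λ _ → [ (λ ()) , Sum.inj₂-injective ]′) (λ _ → inj₂ ∘′ cong inj₂)) ⟩
  count (p ≟ₚ_) (deg2 n)
    ≡⟨ count-unique (p ≟ₚ_) (deg2-unique n) p∈ refl (λ _ → sym) ⟩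
  1 ∎
  where
  open ≡-Reasoning
  n = suc m

product-vertices : ∀ m (f : ℕ → ℕ) →
  product (map (λ u → f (d (suc m) u)) (PAH-V (suc m))) ≡ f 3 ^ length (benzVerts (suc m)) * f 1 ^ length (deg2 (suc m))
product-vertices m f = product-map-++-const (λ u → f (d (suc m) u)) inj₁ inj₂ (benzVerts (suc m)) (deg2 (suc m))
  (cong f ∘′ d-lattice-vertex {m}) (cong f ∘′ d-leaf {m})

product-edges : ∀ m (g : ℕ → ℕ → ℕ) →
  product (map (λ e → g (d (suc m) (proj₁ e)) (d (suc m) (proj₂ e))) (PAH-E (suc m)))
    ≡ g 3 3 ^ length (benzEdges (suc m)) * g 3 1 ^ length (deg2 (suc m))
product-edges m g = product-map-++-const G lattice-edge leaf-edge (benzEdges (suc m)) (deg2 (suc m)) lattice-edge-degrees leaf-edge-degrees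
  where
  G = λ e → g (d (suc m) (proj₁ e)) (d (suc m) (proj₂ e))
  lattice-edge-degrees : ∀ {e} → e ∈ benzEdges (suc m) → G (lattice-edge e) ≡ g 3 3
  lattice-edge-degrees e∈ with benzEdges-valid {m} e∈
  ... | _ , u∈ , v∈ = cong₂ g (d-lattice-vertex {m} u∈) (d-lattice-vertex {m} v∈)
  leaf-edge-degrees : ∀ {q} → q ∈ deg2 (suc m) → G (leaf-edge q) ≡ g 3 1
  leaf-edge-degrees q∈ = cong₂ g (d-lattice-vertex {m} (proj₁ (∈-filter⁻ (λ p → deg (suc m) p ≟ 2) {xs = benzVerts (suc m)} q∈)))
                                 (d-leaf {m} q∈)

module Exponents (n v e l : ℕ) (v≡6n² : v ≡ 6 * n ^ 2) (l≡6n : l ≡ 6 * n) (2e+l≡3v : 2 * e + l ≡ 3 * v) where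
  open ≡-Reasoning

  2e+6n≡18n² : 2 * e + 6 * n ≡ 18 * n ^ 2
  2e+6n≡18n² = trans (cong (_+_ (2 * e)) (sym l≡6n)) (trans 2e+l≡3v (trans (cong (3 *_) v≡6n²) (sym (ℕ.*-assoc 3 6 (n ^ 2)))))

  2e≡ : 2 * e ≡ 18 * n ^ 2 ∸ 6 * n
  2e≡ = trans (sym (ℕ.m+n∸n≡m (2 * e) (6 * n))) (cong (_∸ 6 * n) 2e+6n≡18n²)

  e≡ : e ≡ 9 * n ^ 2 ∸ 3 * n
  e≡ = trans (sym (ℕ.m+n∸n≡m e (3 * n))) (cong (_∸ 3 * n) e+3n≡9n²)
    where
    double : ∀ e n → 2 * (e + 3 * n) ≡ 2 * e + 6 * n
    double = ℕ-Solver.solve-∀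
    e+3n≡9n² : e + 3 * n ≡ 9 * n ^ 2
    e+3n≡9n² = ℕ.*-cancelˡ-≡ (e + 3 * n) (9 * n ^ 2) 2 (trans (double e n) (trans 2e+6n≡18n² (ℕ.*-assoc 2 9 (n ^ 2))))

  squared-degrees : 9 ^ v * 1 ^ l ≡ 3 ^ (12 * n ^ 2)
  squared-degrees = begin
    9 ^ v * 1 ^ l     ≡⟨ cong₂ _*_ (ℕ.^-*-assoc 3 2 v) (ℕ.^-zeroˡ l) ⟩
    3 ^ (2 * v) * 1   ≡⟨ ℕ.*-identityʳ _ ⟩
    3 ^ (2 * v)       ≡⟨ cong (λ x → 3 ^ (2 * x)) v≡6n² ⟩
    3 ^ (2 * (6 * n ^ 2)) ≡⟨ cong (3 ^_) (sym (ℕ.*-assoc 2 6 (n ^ 2))) ⟩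
    3 ^ (12 * n ^ 2)  ∎

  degrees : 3 ^ v * 1 ^ l ≡ 3 ^ (6 * n ^ 2)
  degrees = trans (cong₂ _*_ (cong (3 ^_) v≡6n²) (ℕ.^-zeroˡ l)) (ℕ.*-identityʳ _)

  degree-products : 9 ^ e * 3 ^ l ≡ 3 ^ (18 * n ^ 2)
  degree-products = begin
    9 ^ e * 3 ^ l      ≡⟨ cong (_* 3 ^ l) (ℕ.^-*-assoc 3 2 e) ⟩
    3 ^ (2 * e) * 3 ^ l ≡⟨ ℕ.^-distribˡ-+-* 3 (2 * e) l ⟨
    3 ^ (2 * e + l)    ≡⟨ cong (3 ^_) (trans (cong (_+_ (2 * e)) l≡6n) 2e+6n≡18n²) ⟩
    3 ^ (18 * n ^ 2)   ∎

  squared-degree-products : 81 ^ e * 9 ^ l ≡ 3 ^ (36 * n ^ 2)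
  squared-degree-products = begin
    81 ^ e * 9 ^ l               ≡⟨ cong₂ _*_ (ℕ.^-*-assoc 3 4 e) (ℕ.^-*-assoc 3 2 l) ⟩
    3 ^ (4 * e) * 3 ^ (2 * l)    ≡⟨ ℕ.^-distribˡ-+-* 3 (4 * e) (2 * l) ⟨
    3 ^ (4 * e + 2 * l)          ≡⟨ cong (3 ^_) (double e l) ⟩
    3 ^ (2 * (2 * e + l))        ≡⟨ cong (λ x → 3 ^ (2 * x)) (trans (cong (_+_ (2 * e)) l≡6n) 2e+6n≡18n²) ⟩
    3 ^ (2 * (18 * n ^ 2))       ≡⟨ cong (3 ^_) (sym (ℕ.*-assoc 2 18 (n ^ 2))) ⟩
    3 ^ (36 * n ^ 2)             ∎
    where
    double : ∀ e l → 4 * e + 2 * l ≡ 2 * (2 * e + l)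
    double = ℕ-Solver.solve-∀

  degree-sums : 6 ^ e * 4 ^ l ≡ 4 ^ (6 * n) * 6 ^ (9 * n ^ 2 ∸ 3 * n)
  degree-sums = trans (ℕ.*-comm (6 ^ e) (4 ^ l)) (cong₂ _*_ (cong (4 ^_) l≡6n) (cong (6 ^_) e≡))

  squared-degree-sums : 36 ^ e * 16 ^ l ≡ 4 ^ (12 * n) * 6 ^ (18 * n ^ 2 ∸ 6 * n)
  squared-degree-sums = begin
    36 ^ e * 16 ^ l            ≡⟨ ℕ.*-comm (36 ^ e) (16 ^ l) ⟩
    16 ^ l * 36 ^ e            ≡⟨ cong₂ _*_ (ℕ.^-*-assoc 4 2 l) (ℕ.^-*-assoc 6 2 e) ⟩
    4 ^ (2 * l) * 6 ^ (2 * e)  ≡⟨ cong₂ _*_ (cong (λ x → 4 ^ (2 * x)) l≡6n) (cong (6 ^_) 2e≡) ⟩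
    4 ^ (2 * (6 * n)) * 6 ^ (18 * n ^ 2 ∸ 6 * n) ≡⟨ cong (λ x → 4 ^ x * 6 ^ (18 * n ^ 2 ∸ 6 * n)) (sym (ℕ.*-assoc 2 6 n)) ⟩
    4 ^ (12 * n) * 6 ^ (18 * n ^ 2 ∸ 6 * n) ∎

corollary2p3 : (n : ℕ) → 1 ≤ n →
    (product (map (λ u → d n u ^ 2) (PAH-V n)) ≡ 3 ^ (12 * n ^ 2))
    × (product (map (λ e → d n (proj₁ e) * d n (proj₂ e)) (PAH-E n)) ≡ 3 ^ (18 * n ^ 2))
    × (product (map (λ v → d n v) (PAH-V n)) ≡ 3 ^ (6 * n ^ 2))
    × (product (map (λ e → d n (proj₁ e) + d n (proj₂ e)) (PAH-E n)) ≡ 4 ^ (6 * n) * 6 ^ (9 * n ^ 2 ∸ 3 * n))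
    × (product (map (λ e → (d n (proj₁ e) + d n (proj₂ e)) ^ 2) (PAH-E n)) ≡ 4 ^ (12 * n) * 6 ^ (18 * n ^ 2 ∸ 6 * n))
    × (product (map (λ e → (d n (proj₁ e) * d n (proj₂ e)) ^ 2) (PAH-E n)) ≡ 3 ^ (36 * n ^ 2))
corollary2p3 (suc m) _ =
    trans (product-vertices m (_^ 2)) squared-degrees
  , trans (product-edges m _*_) degree-products
  , trans (product-vertices m id) degrees
  , trans (product-edges m _+_) degree-sums
  , trans (product-edges m (λ a b → (a + b) ^ 2)) squared-degree-sums
  , trans (product-edges m (λ a b → (a * b) ^ 2)) squared-degree-products
  where
  open Exponents (suc m) _ (length (benzEdges (suc m))) _ (length-benzVerts m) (length-deg2 m) (benzenoid-handshake m)
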